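{- Let $k\geq 2$, $2\leq r\leq k$ and $1\leq t\leq k$ be integers. Then for all sufficiently large $n$, $$ {\rm ex}_r(n,{\rm Berge}\text{ - }M_t\cup (k-t)S_2)=\binom{k-1}{r-1}(n-k+1)+\binom{k-1}{r}. $$
   Context: An $r$-graph is a hypergraph whose hyperedges are distinct $r$-element subsets of the vertex set. For a graph $F$, an $r$-graph $H$ is a Berge-$F$ if there is a bijection $\phi:E(F)\to E(H)$ with $e\subseteq\phi(e)$ for each $e\in E(F)$; an $r$-graph contains a Berge-$F$ if some subhypergraph is a Berge-$F$. ${\rm ex}_r(n,{\rm Berge}\text{ - }F)$ is the maximum number of hyperedges in an $n$-vertex $r$-graph containing no Berge-$F$. $M_t$ is a matching of $t$ independent edges, $S_2$ is the star with $2$ edges, $G_1\cup G_2$ is vertex-disjoint union and $cG$ is the disjoint union of $c$ copies of $G$ ($0G$ is empty). Convention: $\binom{a}{b}=0$ if $a<b$. -}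

module Defs where

open import Data.Nat using (ℕ; zero; suc; _+_; _*_)
open import Data.Fin using (Fin; zero; suc; _↑ˡ_; _↑ʳ_)
open import Data.Fin.Subset using (Subset; _∈_; ∣_∣)
open import Data.List using (List; []; _∷_; _++_; map; length; lookup)
open import Data.List.Relation.Unary.All using (All)
open import Data.List.Relation.Unary.Unique.Propositional using (Unique)
open import Data.Product using (Σ; _×_; _,_; proj₁; proj₂)
open import Function.Definitions using (Injective)
open import Relation.Binary.PropositionalEquality using (_≡_)
open import Relation.Nullary using (¬_)

record Graph : Set where
  field
    nV    : ℕ
    edges : List (Fin nV × Fin nV)
open Graph public

emptyG : Graph
emptyG = record { nV = 0 ; edges = [] }

K2 : Graph
K2 = record { nV = 2 ; edges = (zero , suc zero) ∷ [] }

S2 : Graph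
S2 = record { nV = 3 ; edges = (zero , suc zero) ∷ (zero , suc (suc zero)) ∷ [] }

_∪G_ : Graph → Graph → Graph
G ∪G H = record
  { nV    = nV G + nV H
  ; edges = map (λ e → (proj₁ e ↑ˡ nV H) , (proj₂ e ↑ˡ nV H)) (edges G)
         ++ map (λ e → (nV G ↑ʳ proj₁ e) , (nV G ↑ʳ proj₂ e)) (edges H) }

copies : ℕ → Graph → Graph
copies zero    G = emptyG
copies (suc c) G = G ∪G copies c G

M : ℕ → Graph
M t = copies t K2

record RGraph (r n : ℕ) : Set where
  field
    hedges   : List (Subset n)
    distinct : Unique hedges
    uniform  : All (λ e → ∣ e ∣ ≡ r) hedges
open RGraph public

ContainsBerge : ∀ {r n} → RGraph r n → Graph → Set
ContainsBerge {r} {n} H F =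
  Σ (Fin (nV F) → Fin n) λ f → Injective _≡_ _≡_ f ×
  Σ (Fin (length (edges F)) → Fin (length (hedges H))) λ φ → Injective _≡_ _≡_ φ ×
  (∀ i → (f (proj₁ (lookup (edges F) i)) ∈ lookup (hedges H) (φ i))
       × (f (proj₂ (lookup (edges F) i)) ∈ lookup (hedges H) (φ i)))

BergeFree : ∀ {r n} → RGraph r n → Graph → Set
BergeFree H F = ¬ ContainsBerge H F

IsExBerge : ℕ → ℕ → Graph → ℕ → Set
IsExBerge r n F m =
  (Σ (RGraph r n) λ H → BergeFree H F × length (hedges H) ≡ m)
  × (∀ (H : RGraph r n) → BergeFree H F → length (hedges H) Data.Nat.≤ m)

-- Lower bound: take all r-sets with at most one vertex outside a fixed (k-1)-set A. In a Berge
-- copy of F = M t ∪ (k-t) S2 every edge of F would have an endpoint mapped into A, but the k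
-- components of F need k distinct such vertices.
--
-- Upper bound: call a vertex huge if its degree is at least D = 8k + 2^(8k). At most 2^|U|
-- hyperedges lie inside a vertex set U, so a huge vertex is the centre of a Berge-S2 avoiding any
-- ≤ 8k prescribed vertices and hyperedges; hence huge vertices carry disjoint Berge-S2's greedily.
-- If there are ≥ k-1 huge vertices B, a hyperedge with two vertices outside B would give a
-- Berge-K2 which, with k-1 stars at B, forms a Berge-F; so all hyperedges have at most one vertex
-- outside B, and there are at most C(k-1,r) + (n-k+1) C(k-1,r-1) of them. If there are s ≤ k-2
-- huge vertices, greedily collect Berge-S2's ("cherries") on small vertices: k-s of them plus
-- stars at the huge vertices give a Berge-F, so the search stops with a set W of at most 2r(k-s)
-- used vertices and no cherry avoiding W. Then the hyperedges with at most one small vertex number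
-- at most C(s,r) + (n-s) C(s,r-1); those meeting W at most |W| D; and, without cherries, every
-- small vertex lies in at most max(C(s,r-2), 1) of the remaining ones, each of which has two small
-- vertices. As C(s,r-1) + max(C(s,r-2), 1) ≤ C(k-1,r-1), the total is below the bound for large n.

{-# OPTIONS --safe #-}
module Submission where

open import Defs
open import Data.Bool using (Bool; true; false; not; _∧_; _∨_; T; T?)
import Data.Bool.Properties as BoolP
open import Data.Empty using (⊥; ⊥-elim)
open import Data.Fin using (Fin; zero; suc; toℕ; fromℕ<; _↑ˡ_; _↑ʳ_; splitAt; join)
import Data.Fin.Properties as FinP
open import Data.Fin.Subset using (Subset; ∣_∣) renaming (_∈_ to _∈ₛ_)
open import Data.Fin.Subset.Properties using () renaming (_∈?_ to _∈ₛ?_)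
open import Data.List using (List; []; _∷_; _++_; map; length; concatMap; take; drop; allFin; filterᵇ)
import Data.List as List
open import Data.List.Properties using (length-++; length-map; length-take; length-drop; concatMap-++; concatMap-map; ++-assoc; ++-identityʳ; take++drop≡id)
open import Data.List.Membership.Propositional using (_∈_; _∉_)
open import Data.List.Membership.Propositional.Properties
  using (∈-map⁺; ∈-map⁻; ∈-++⁺ˡ; ∈-++⁺ʳ; ∈-lookup; ∈-allFin; ∈-filter⁺; ∈-filter⁻)
open import Data.List.Relation.Binary.Disjoint.Propositional using (Disjoint)
open import Data.List.Relation.Unary.All using (All; []; _∷_)
import Data.List.Relation.Unary.All as All
import Data.List.Relation.Unary.All.Properties as AllP
open import Data.List.Relation.Unary.Any using (here; there; index; any?)
open import Data.List.Relation.Unary.Any.Properties using (lookup-index)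
open import Data.List.Relation.Unary.Unique.Propositional using (Unique; []; _∷_)
import Data.List.Relation.Unary.Unique.Propositional.Properties as UniqueP
open import Data.Nat using (ℕ; zero; suc; _+_; _*_; _∸_; _^_; _⊓_; _⊔_; _≤_; _<_; z≤n; s≤s; s≤s⁻¹; _≡ᵇ_; _≤ᵇ_; _<ᵇ_; _≤?_; _<?_)
open import Data.Nat.Properties
open import Data.Nat.ListAction using (sum)
open import Data.Nat.Combinatorics using (_C_; nCn≡1; k>n⇒nCk≡0; nCk≡nC[n∸k]; nCk+nC[k+1]≡[n+1]C[k+1])
open import Data.Nat.Tactic.RingSolver using (solve-∀)
open import Data.Product using (Σ; _×_; _,_; proj₁; proj₂)
open import Data.Sum using (_⊎_; inj₁; inj₂; [_,_]′)
open import Data.Vec using ([]; _∷_; lookup; tabulate; replicate)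
import Data.Vec.Properties as VecP
open import Function using (_∘_)
open import Function.Definitions using (Injective)
open import Relation.Nullary using (¬_; Dec; yes; no; does)
open import Relation.Nullary.Decidable using (_×-dec_; _→-dec_; ¬?; dec-true)
open import Relation.Binary.PropositionalEquality

private variable
  X Y : Set

𝟙 : Bool → ℕ
𝟙 true  = 1
𝟙 false = 0

sumFin : (n : ℕ) → (Fin n → ℕ) → ℕ
sumFin zero    f = 0
sumFin (suc n) f = f zero + sumFin n (λ v → f (suc v))

sumFin-cong : ∀ n {f g : Fin n → ℕ} → (∀ v → f v ≡ g v) → sumFin n f ≡ sumFin n g
sumFin-cong zero    h = refl
sumFin-cong (suc n) h = cong₂ _+_ (h zero) (sumFin-cong n (λ v → h (suc v)))

sumFin-mono : ∀ n {f g : Fin n → ℕ} → (∀ v → f v ≤ g v) → sumFin n f ≤ sumFin n g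
sumFin-mono zero    h = z≤n
sumFin-mono (suc n) h = +-mono-≤ (h zero) (sumFin-mono n (λ v → h (suc v)))

sumFin-+ : ∀ n (f g : Fin n → ℕ) → sumFin n (λ v → f v + g v) ≡ sumFin n f + sumFin n g
sumFin-+ zero    f g = refl
sumFin-+ (suc n) f g = trans (cong (f zero + g zero +_) (sumFin-+ n _ _)) (shuffle (f zero) (g zero) _ _)
  where
  shuffle : ∀ a b c d → a + b + (c + d) ≡ a + c + (b + d)
  shuffle = solve-∀

sumFin-*ʳ : ∀ n (f : Fin n → ℕ) c → sumFin n (λ v → f v * c) ≡ sumFin n f * c
sumFin-*ʳ zero    f c = refl
sumFin-*ʳ (suc n) f c = trans (cong (f zero * c +_) (sumFin-*ʳ n _ c)) (sym (*-distribʳ-+ c (f zero) _))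

sumFin-zero : ∀ n {g : Fin n → ℕ} → (∀ w → g w ≡ 0) → sumFin n g ≡ 0
sumFin-zero zero    h = refl
sumFin-zero (suc n) h = cong₂ _+_ (h zero) (sumFin-zero n (λ w → h (suc w)))

sumFin-single : ∀ n {g : Fin n → ℕ} a → g a ≡ 1 → (∀ w → w ≢ a → g w ≡ 0) → sumFin n g ≡ 1
sumFin-single (suc n) zero    ga h = cong₂ _+_ ga (sumFin-zero n (λ w → h (suc w) λ ()))
sumFin-single (suc n) (suc a) ga h =
  cong₂ _+_ (h zero λ ()) (sumFin-single n a ga (λ w w≢a → h (suc w) (w≢a ∘ FinP.suc-injective)))

sumFin-pair : ∀ n {g : Fin n → ℕ} a b → a ≢ b → g a ≡ 1 → g b ≡ 1 → (∀ w → w ≢ a → w ≢ b → g w ≡ 0) → sumFin n g ≡ 2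
sumFin-pair (suc n) zero    zero    a≢b ga gb h = ⊥-elim (a≢b refl)
sumFin-pair (suc n) zero    (suc b) a≢b ga gb h =
  cong₂ _+_ ga (sumFin-single n b gb (λ w w≢b → h (suc w) (λ ()) (λ e → w≢b (FinP.suc-injective e))))
sumFin-pair (suc n) (suc a) zero    a≢b ga gb h =
  cong₂ _+_ gb (sumFin-single n a ga (λ w w≢a → h (suc w) (λ e → w≢a (FinP.suc-injective e)) (λ ())))
sumFin-pair (suc n) (suc a) (suc b) a≢b ga gb h =
  cong₂ _+_ (h zero (λ ()) (λ ()))
    (sumFin-pair n a b (λ e → a≢b (cong suc e)) ga gb
      (λ w w≢a w≢b → h (suc w) (λ e → w≢a (FinP.suc-injective e)) (λ e → w≢b (FinP.suc-injective e))))

term≤sumFin : ∀ n (g : Fin n → ℕ) x → g x ≤ sumFin n g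
term≤sumFin (suc n) g zero    = m≤m+n (g zero) _
term≤sumFin (suc n) g (suc x) = ≤-trans (term≤sumFin n (λ v → g (suc v)) x) (m≤n+m _ (g zero))

twoTerms≤sumFin : ∀ n (g : Fin n → ℕ) x y → x ≢ y → g x + g y ≤ sumFin n g
twoTerms≤sumFin (suc n) g zero    zero    x≢y = ⊥-elim (x≢y refl)
twoTerms≤sumFin (suc n) g zero    (suc y) x≢y = +-monoʳ-≤ (g zero) (term≤sumFin n (λ v → g (suc v)) y)
twoTerms≤sumFin (suc n) g (suc x) zero    x≢y =
  subst (_≤ sumFin (suc n) g) (+-comm (g zero) (g (suc x))) (+-monoʳ-≤ (g zero) (term≤sumFin n (λ v → g (suc v)) x))
twoTerms≤sumFin (suc n) g (suc x) (suc y) x≢y =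
  ≤-trans (twoTerms≤sumFin n (λ v → g (suc v)) x y (λ e → x≢y (cong suc e))) (m≤n+m _ (g zero))

∃-true-of-1≤count : ∀ n (P : Fin n → Bool) → 1 ≤ sumFin n (λ v → 𝟙 (P v)) → Σ (Fin n) λ x → P x ≡ true
∃-true-of-1≤count (suc n) P le with P zero in e
... | true  = zero , e
... | false with ∃-true-of-1≤count n (λ v → P (suc v)) le
...   | x , px = suc x , px

∃₂-true-of-2≤count : ∀ n (P : Fin n → Bool) → 2 ≤ sumFin n (λ v → 𝟙 (P v)) →
  Σ (Fin n) λ x → Σ (Fin n) λ y → x ≢ y × P x ≡ true × P y ≡ true
∃₂-true-of-2≤count (suc n) P le with P zero in e
... | true with ∃-true-of-1≤count n (λ v → P (suc v)) (s≤s⁻¹ le)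
...   | y , py = zero , suc y , (λ ()) , e , py
∃₂-true-of-2≤count (suc n) P le | false with ∃₂-true-of-2≤count n (λ v → P (suc v)) le
...   | x , y , x≢y , px , py = suc x , suc y , (λ e → x≢y (FinP.suc-injective e)) , px , py

countᵇ : (X → Bool) → List X → ℕ
countᵇ p []       = 0
countᵇ p (x ∷ xs) = 𝟙 (p x) + countᵇ p xs

countᵇ-++ : ∀ (p : X → Bool) xs ys → countᵇ p (xs ++ ys) ≡ countᵇ p xs + countᵇ p ys
countᵇ-++ p []       ys = refl
countᵇ-++ p (x ∷ xs) ys = trans (cong (𝟙 (p x) +_) (countᵇ-++ p xs ys)) (sym (+-assoc (𝟙 (p x)) _ _))

countᵇ-map : ∀ (p : Y → Bool) (f : X → Y) xs → countᵇ p (map f xs) ≡ countᵇ (p ∘ f) xs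
countᵇ-map p f []       = refl
countᵇ-map p f (x ∷ xs) = cong (𝟙 (p (f x)) +_) (countᵇ-map p f xs)

countᵇ-cong : ∀ {p q : X → Bool} xs → (∀ x → p x ≡ q x) → countᵇ p xs ≡ countᵇ q xs
countᵇ-cong []       e = refl
countᵇ-cong (x ∷ xs) e = cong₂ _+_ (cong 𝟙 (e x)) (countᵇ-cong xs e)

countᵇ-none : ∀ {p : X → Bool} xs → (∀ x → p x ≡ false) → countᵇ p xs ≡ 0
countᵇ-none []       e = refl
countᵇ-none (x ∷ xs) e rewrite e x = countᵇ-none xs e

countᵇ-const-true : (xs : List X) → countᵇ (λ _ → true) xs ≡ length xs
countᵇ-const-true []       = refl
countᵇ-const-true (x ∷ xs) = cong suc (countᵇ-const-true xs)

countᵇ+countᵇ-not : ∀ (p : X → Bool) xs → countᵇ p xs + countᵇ (not ∘ p) xs ≡ length xs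
countᵇ+countᵇ-not p []       = refl
countᵇ+countᵇ-not p (x ∷ xs) with p x
... | true  = cong suc (countᵇ+countᵇ-not p xs)
... | false = trans (+-suc _ _) (cong suc (countᵇ+countᵇ-not p xs))

countᵇ-≤-∨ : ∀ (p q₁ q₂ : X → Bool) xs → (∀ x → x ∈ xs → p x ≡ true → q₁ x ≡ true ⊎ q₂ x ≡ true) →
  countᵇ p xs ≤ countᵇ q₁ xs + countᵇ q₂ xs
countᵇ-≤-∨ p q₁ q₂ []       h = z≤n
countᵇ-≤-∨ p q₁ q₂ (x ∷ xs) h with p x in px | q₁ x in q₁x | q₂ x in q₂x | h x (here refl)
... | false | a     | b     | _ = ≤-trans rest (+-mono-≤ (m≤n+m _ (𝟙 a)) (m≤n+m _ (𝟙 b)))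
  where rest = countᵇ-≤-∨ p q₁ q₂ xs (λ y m → h y (there m))
... | true  | true  | b     | _ = s≤s (≤-trans rest (+-monoʳ-≤ (countᵇ q₁ xs) (m≤n+m (countᵇ q₂ xs) (𝟙 b))))
  where rest = countᵇ-≤-∨ p q₁ q₂ xs (λ y m → h y (there m))
... | true  | false | true  | _ = subst (suc (countᵇ p xs) ≤_) (sym (+-suc _ _)) (s≤s rest)
  where rest = countᵇ-≤-∨ p q₁ q₂ xs (λ y m → h y (there m))
... | true  | false | false | hx with hx refl
...   | inj₁ ()
...   | inj₂ ()

countᵇ≤sum : ∀ (p : X → Bool) (f : X → ℕ) xs → (∀ x → x ∈ xs → 𝟙 (p x) ≤ f x) → countᵇ p xs ≤ sum (map f xs)
countᵇ≤sum p f []       h = z≤n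
countᵇ≤sum p f (x ∷ xs) h = +-mono-≤ (h x (here refl)) (countᵇ≤sum p f xs (λ y m → h y (there m)))

*-length≤sum : ∀ c (f : X → ℕ) xs → (∀ x → x ∈ xs → c ≤ f x) → c * length xs ≤ sum (map f xs)
*-length≤sum c f []       h = ≤-reflexive (*-zeroʳ c)
*-length≤sum c f (x ∷ xs) h =
  ≤-trans (≤-reflexive (*-suc c (length xs))) (+-mono-≤ (h x (here refl)) (*-length≤sum c f xs (λ y m → h y (there m))))

sum-sumFin-swap : ∀ n (g : X → Fin n → Bool) xs →
  sum (map (λ S → sumFin n (λ v → 𝟙 (g S v))) xs) ≡ sumFin n (λ v → countᵇ (λ S → g S v) xs)
sum-sumFin-swap n g []       = sym (sumFin-zero n (λ _ → refl))
sum-sumFin-swap n g (x ∷ xs) = trans (cong (sumFin n (λ v → 𝟙 (g x v)) +_) (sum-sumFin-swap n g xs)) (sym (sumFin-+ n _ _))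

countᵇ-tabulate : ∀ n (g : Fin n → X) (p : X → Bool) → countᵇ p (List.tabulate g) ≡ sumFin n (λ v → 𝟙 (p (g v)))
countᵇ-tabulate zero    g p = refl
countᵇ-tabulate (suc n) g p = cong (𝟙 (p (g zero)) +_) (countᵇ-tabulate n (g ∘ suc) p)

T⇒≡true : ∀ {b} → T b → b ≡ true
T⇒≡true {true} _ = refl

≡true⇒T : ∀ {b} → b ≡ true → T b
≡true⇒T refl = _

true≢false : ∀ {b} → b ≡ true → b ≡ false → ⊥
true≢false refl ()

not≡true : ∀ {b} → not b ≡ true → b ≡ false
not≡true {false} _ = refl

length-filterᵇ : ∀ (p : X → Bool) xs → length (filterᵇ p xs) ≡ countᵇ p xs
length-filterᵇ p []       = refl
length-filterᵇ p (x ∷ xs) with p x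
... | true  = cong suc (length-filterᵇ p xs)
... | false = length-filterᵇ p xs

∈-filterᵇ⁻ : ∀ (p : X → Bool) {xs x} → x ∈ filterᵇ p xs → x ∈ xs × p x ≡ true
∈-filterᵇ⁻ p m with ∈-filter⁻ (λ x → T? (p x)) m
... | m′ , px = m′ , T⇒≡true px

∈-filterᵇ⁺ : ∀ (p : X → Bool) {xs x} → x ∈ xs → p x ≡ true → x ∈ filterᵇ p xs
∈-filterᵇ⁺ p m px = ∈-filter⁺ (λ x → T? (p x)) m (≡true⇒T px)

filterᵇ-unique : ∀ (p : X → Bool) {xs} → Unique xs → Unique (filterᵇ p xs)
filterᵇ-unique p = UniqueP.filter⁺ (λ x → T? (p x))

module _ (_≟_ : (x y : X) → Dec (x ≡ y)) where

  private
    remove : X → List X → List X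
    remove x []       = []
    remove x (y ∷ ys) with x ≟ y
    ... | yes _ = ys
    ... | no  _ = y ∷ remove x ys

    countᵇ-remove : ∀ (p : X → Bool) x ys → x ∈ ys → p x ≡ true → countᵇ p ys ≡ suc (countᵇ p (remove x ys))
    countᵇ-remove p x (y ∷ ys) m px with x ≟ y
    countᵇ-remove p x (y ∷ ys) m          px | yes refl rewrite px = refl
    countᵇ-remove p x (y ∷ ys) (here x≡y) px | no x≢y = ⊥-elim (x≢y x≡y)
    countᵇ-remove p x (y ∷ ys) (there m)  px | no _ =
      trans (cong (𝟙 (p y) +_) (countᵇ-remove p x ys m px)) (+-suc (𝟙 (p y)) _)

    ∈-remove : ∀ x z ys → z ∈ ys → z ≢ x → z ∈ remove x ys
    ∈-remove x z (y ∷ ys) m z≢x with x ≟ y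
    ∈-remove x z (y ∷ ys) (here refl) z≢x | yes refl = ⊥-elim (z≢x refl)
    ∈-remove x z (y ∷ ys) (there m)   z≢x | yes refl = m
    ∈-remove x z (y ∷ ys) (here z≡y)  z≢x | no _ = here z≡y
    ∈-remove x z (y ∷ ys) (there m)   z≢x | no _ = there (∈-remove x z ys m z≢x)

  length≤countᵇ : ∀ (p : X → Bool) xs ys → Unique xs → All (λ x → p x ≡ true) xs →
    (∀ {x} → x ∈ xs → x ∈ ys) → length xs ≤ countᵇ p ys
  length≤countᵇ p []       ys u          a          xs⊆ys = z≤n
  length≤countᵇ p (x ∷ xs) ys (x∉xs ∷ u) (px ∷ a)  xs⊆ys =
    subst (suc (length xs) ≤_) (sym (countᵇ-remove p x ys (xs⊆ys (here refl)) px))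
      (s≤s (length≤countᵇ p xs (remove x ys) u a
        (λ {z} z∈xs → ∈-remove x z ys (xs⊆ys (there z∈xs)) (λ z≡x → All.lookup x∉xs z∈xs (sym z≡x)))))

  Unique⇒length≤ : ∀ {xs ys} → Unique xs → (∀ {x} → x ∈ xs → x ∈ ys) → length xs ≤ length ys
  Unique⇒length≤ {xs} {ys} u xs⊆ys =
    subst (length xs ≤_) (countᵇ-const-true ys)
      (length≤countᵇ (λ _ → true) xs ys u (All.tabulate (λ _ → refl)) xs⊆ys)

Unique-map⁺-on : ∀ (g : X → Y) xs → Unique xs → (∀ {x y} → x ∈ xs → y ∈ xs → g x ≡ g y → x ≡ y) → Unique (map g xs)
Unique-map⁺-on g []       u        inj = []
Unique-map⁺-on g (x ∷ xs) (a ∷ u) inj =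
  map-≢ xs a (λ m → inj (here refl) (there m)) ∷ Unique-map⁺-on g xs u (λ m₁ m₂ → inj (there m₁) (there m₂))
  where
  map-≢ : ∀ zs → All (x ≢_) zs → (∀ {z} → z ∈ zs → g x ≡ g z → x ≡ z) → All (g x ≢_) (map g zs)
  map-≢ []       _        _ = []
  map-≢ (z ∷ zs) (q ∷ qs) h = (λ e → q (h (here refl) e)) ∷ map-≢ zs qs (λ m → h (there m))

length≤-injectiveOn : ((x y : Y) → Dec (x ≡ y)) → ∀ (g : X → Y) {xs ys} → Unique xs →
  (∀ {x y} → x ∈ xs → y ∈ xs → g x ≡ g y → x ≡ y) → (∀ {x} → x ∈ xs → g x ∈ ys) → length xs ≤ length ys
length≤-injectiveOn _≟_ g {xs} u inj g∈ys =
  subst (_≤ _) (length-map g xs) (Unique⇒length≤ _≟_ (Unique-map⁺-on g xs u inj) image⊆ys)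
  where
  image⊆ys : ∀ {z} → z ∈ map g xs → z ∈ _
  image⊆ys m with ∈-map⁻ g m
  ... | x , x∈xs , refl = g∈ys x∈xs

Unique-++⁻ : ∀ (xs : List X) {ys} → Unique (xs ++ ys) → Unique xs × Unique ys × Disjoint xs ys
Unique-++⁻ []       u       = [] , u , λ ()
Unique-++⁻ (x ∷ xs) {ys} (a ∷ u) with Unique-++⁻ xs u
... | uxs , uys , disj = AllP.++⁻ˡ xs a ∷ uxs , uys , disj′
  where
  disj′ : Disjoint (x ∷ xs) ys
  disj′ (here refl , m) = All.lookup (AllP.++⁻ʳ xs a) m refl
  disj′ (there m₁  , m₂) = disj (m₁ , m₂)

member? : ((x y : X) → Dec (x ≡ y)) → (x : X) (xs : List X) → Dec (x ∈ xs)
member? _≟_ x = any? (x ≟_)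

does-true⇒ : ∀ {P : Set} (d : Dec P) → does d ≡ true → P
does-true⇒ (yes p) _ = p

does-false⇒¬ : ∀ {P : Set} (d : Dec P) → does d ≡ false → ¬ P
does-false⇒¬ (no ¬p) _ = ¬p

card : ∀ {n} → Subset n → ℕ
card {n} S = sumFin n (λ v → 𝟙 (lookup S v))

outside : ∀ {n} → Subset n → Subset n → ℕ
outside {n} A S = sumFin n (λ v → 𝟙 (lookup S v ∧ not (lookup A v)))

∣∣≡card : ∀ {n} (S : Subset n) → ∣ S ∣ ≡ card S
∣∣≡card []          = refl
∣∣≡card (true ∷ S)  = cong suc (∣∣≡card S)
∣∣≡card (false ∷ S) = ∣∣≡card S

card≤ : ∀ {n} (S : Subset n) → card S ≤ n
card≤ []          = z≤n
card≤ (true ∷ S)  = s≤s (card≤ S)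
card≤ (false ∷ S) = m≤n⇒m≤1+n (card≤ S)

card-replicate-false : ∀ n → card (replicate n false) ≡ 0
card-replicate-false zero    = refl
card-replicate-false (suc n) = card-replicate-false n

outside+card : ∀ {n} (S : Subset n) → sumFin n (λ v → 𝟙 (not (lookup S v))) + card S ≡ n
outside+card []          = refl
outside+card (true ∷ S)  = trans (+-suc _ _) (cong suc (outside+card S))
outside+card (false ∷ S) = cong suc (outside+card S)

_≟ₛ_ : ∀ {n} (S T : Subset n) → Dec (S ≡ T)
_≟ₛ_ = VecP.≡-dec BoolP._≟_

subset-ext : ∀ {n} (S T : Subset n) → (∀ v → lookup S v ≡ lookup T v) → S ≡ T
subset-ext S T h = trans (sym (VecP.tabulate∘lookup S)) (trans (VecP.tabulate-cong h) (VecP.tabulate∘lookup T))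

allSubsets : (n : ℕ) → List (Subset n)
allSubsets zero    = [] ∷ []
allSubsets (suc n) = map (false ∷_) (allSubsets n) ++ map (true ∷_) (allSubsets n)

allSubsets-unique : ∀ n → Unique (allSubsets n)
allSubsets-unique zero    = [] ∷ []
allSubsets-unique (suc n) =
  UniqueP.++⁺ (UniqueP.map⁺ (proj₂ ∘ VecP.∷-injective) (allSubsets-unique n))
              (UniqueP.map⁺ (proj₂ ∘ VecP.∷-injective) (allSubsets-unique n)) disjoint
  where
  disjoint : Disjoint (map (false ∷_) (allSubsets n)) (map (true ∷_) (allSubsets n))
  disjoint (m₁ , m₂) with ∈-map⁻ (false ∷_) m₁ | ∈-map⁻ (true ∷_) m₂
  ... | _ , _ , refl | _ , _ , ()

∈-allSubsets : ∀ {n} (S : Subset n) → S ∈ allSubsets n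
∈-allSubsets []                   = here refl
∈-allSubsets {suc n} (false ∷ S) = ∈-++⁺ˡ (∈-map⁺ (false ∷_) (∈-allSubsets S))
∈-allSubsets {suc n} (true ∷ S)  = ∈-++⁺ʳ (map (false ∷_) (allSubsets n)) (∈-map⁺ (true ∷_) (∈-allSubsets S))

length-allSubsets : ∀ n → length (allSubsets n) ≡ 2 ^ n
length-allSubsets zero    = refl
length-allSubsets (suc n) = begin
  length (map (false ∷_) (allSubsets n) ++ map (true ∷_) (allSubsets n))
    ≡⟨ length-++ (map (false ∷_) (allSubsets n)) ⟩
  length (map (false ∷_) (allSubsets n)) + length (map (true ∷_) (allSubsets n))
    ≡⟨ cong₂ _+_ (length-map (false ∷_) (allSubsets n)) (length-map (true ∷_) (allSubsets n)) ⟩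
  length (allSubsets n) + length (allSubsets n)
    ≡⟨ cong₂ _+_ (length-allSubsets n) (trans (length-allSubsets n) (sym (+-identityʳ _))) ⟩
  2 ^ suc n ∎
  where open ≡-Reasoning

fromList : ∀ {n} → List (Fin n) → Subset n
fromList vs = tabulate (λ v → does (member? FinP._≟_ v vs))

lookup-fromList : ∀ {n} (vs : List (Fin n)) v → lookup (fromList vs) v ≡ does (member? FinP._≟_ v vs)
lookup-fromList vs = VecP.lookup∘tabulate _

card-fromList : ∀ {n} (vs : List (Fin n)) → Unique vs → card (fromList vs) ≡ length vs
card-fromList {n} vs u = ≤-antisym card≤length length≤card
  where
  p : Fin n → Bool
  p v = does (member? FinP._≟_ v vs)
  card≡count : card (fromList vs) ≡ countᵇ p (allFin n)
  card≡count = trans (sumFin-cong n (λ v → cong 𝟙 (lookup-fromList vs v))) (sym (countᵇ-tabulate n (λ v → v) p))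
  length≤card : length vs ≤ card (fromList vs)
  length≤card = subst (length vs ≤_) (sym card≡count)
    (length≤countᵇ FinP._≟_ p vs (allFin n) u (All.tabulate (dec-true (member? FinP._≟_ _ vs))) (λ _ → ∈-allFin _))
  card≤length : card (fromList vs) ≤ length vs
  card≤length = subst (_≤ length vs) (trans (length-filterᵇ p (allFin n)) (sym card≡count))
    (Unique⇒length≤ FinP._≟_ (filterᵇ-unique p (UniqueP.allFin⁺ n))
      (λ m → does-true⇒ (member? FinP._≟_ _ vs) (proj₂ (∈-filterᵇ⁻ p {allFin n} m))))

choose : ℕ → ℕ → ℕ
choose zero    zero    = 1
choose zero    (suc k) = 0
choose (suc n) zero    = 1
choose (suc n) (suc k) = choose n k + choose n (suc k)

choose≡C : ∀ n k → choose n k ≡ n C k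
choose≡C zero    zero    = sym (nCn≡1 0)
choose≡C zero    (suc k) = sym (k>n⇒nCk≡0 {0} {suc k} (s≤s z≤n))
choose≡C (suc n) zero    = sym (trans (nCk≡nC[n∸k] {0} {suc n} z≤n) (nCn≡1 (suc n)))
choose≡C (suc n) (suc k) = trans (cong₂ _+_ (choose≡C n k) (choose≡C n (suc k))) (nCk+nC[k+1]≡[n+1]C[k+1] n k)

choose-0 : ∀ n → choose n 0 ≡ 1
choose-0 zero    = refl
choose-0 (suc n) = refl

choose-1 : ∀ n → choose n 1 ≡ n
choose-1 zero    = refl
choose-1 (suc n) = cong₂ _+_ (choose-0 n) (choose-1 n)

choose≤2^ : ∀ n k → choose n k ≤ 2 ^ n
choose≤2^ zero    zero    = ≤-refl
choose≤2^ zero    (suc k) = z≤n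
choose≤2^ (suc n) zero    = m^n>0 2 (suc n)
choose≤2^ (suc n) (suc k) =
  ≤-trans (+-mono-≤ (choose≤2^ n k) (choose≤2^ n (suc k))) (≤-reflexive (cong (2 ^ n +_) (sym (+-identityʳ (2 ^ n)))))

choose-monoˡ : ∀ {m m′} k → m ≤ m′ → choose m k ≤ choose m′ k
choose-monoˡ {m} {m′}      zero    _       = ≤-reflexive (trans (choose-0 m) (sym (choose-0 m′)))
choose-monoˡ               (suc k) z≤n     = z≤n
choose-monoˡ {suc m} {suc m′} (suc k) (s≤s le) = +-mono-≤ (choose-monoˡ k le) (choose-monoˡ (suc k) le)

1≤choose : ∀ n k → k ≤ n → 1 ≤ choose n k
1≤choose zero    zero    _        = ≤-refl
1≤choose (suc n) zero    _        = ≤-refl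
1≤choose (suc n) (suc k) (s≤s le) = ≤-trans (1≤choose n k le) (m≤m+n _ _)

choose-pascal-bound : ∀ {s m} j → s ≤ m → j ≤ m → choose s (suc j) + (choose s j ⊔ 1) ≤ choose (suc m) (suc j)
choose-pascal-bound {s} {m} j s≤m j≤m = begin
  choose s (suc j) + (choose s j ⊔ 1)                       ≡⟨ +-distribˡ-⊔ (choose s (suc j)) (choose s j) 1 ⟩
  (choose s (suc j) + choose s j) ⊔ (choose s (suc j) + 1)  ≤⟨ ⊔-lub both one ⟩
  choose m j + choose m (suc j)                             ∎
  where
  open ≤-Reasoning
  both : choose s (suc j) + choose s j ≤ choose m j + choose m (suc j)
  both = ≤-trans (≤-reflexive (+-comm (choose s (suc j)) (choose s j))) (+-mono-≤ (choose-monoˡ j s≤m) (choose-monoˡ (suc j) s≤m))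
  one : choose s (suc j) + 1 ≤ choose m j + choose m (suc j)
  one = ≤-trans (≤-reflexive (+-comm (choose s (suc j)) 1)) (+-mono-≤ (1≤choose m j j≤m) (choose-monoˡ (suc j) s≤m))

fewOutside : ∀ {n} → Subset n → ℕ → ℕ → Subset n → Bool
fewOutside A r j S = (card S ≡ᵇ r) ∧ (outside A S ≤ᵇ j)

fewOutside-sound : ∀ {n} (A : Subset n) r j S → fewOutside A r j S ≡ true → card S ≡ r × outside A S ≤ j
fewOutside-sound A r j S e =
  ≡ᵇ⇒≡ _ _ (≡true⇒T (BoolP.∧-conicalˡ _ _ e)) , ≤ᵇ⇒≤ _ _ (≡true⇒T (BoolP.∧-conicalʳ _ _ e))

fewOutside-complete : ∀ {n} (A : Subset n) r j S → card S ≡ r → outside A S ≤ j → fewOutside A r j S ≡ true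
fewOutside-complete A r j S refl le
  rewrite T⇒≡true (≡⇒≡ᵇ (card S) (card S) refl) = T⇒≡true (≤⇒≤ᵇ le)

private
  countᵇ-allSubsets-suc : ∀ {n} (p : Subset (suc n) → Bool) →
    countᵇ p (allSubsets (suc n)) ≡ countᵇ (p ∘ (false ∷_)) (allSubsets n) + countᵇ (p ∘ (true ∷_)) (allSubsets n)
  countᵇ-allSubsets-suc {n} p = trans (countᵇ-++ p (map (false ∷_) (allSubsets n)) _)
    (cong₂ _+_ (countᵇ-map p (false ∷_) (allSubsets n)) (countᵇ-map p (true ∷_) (allSubsets n)))

  ≤ᵇ-suc : ∀ m j → (suc m ≤ᵇ suc j) ≡ (m ≤ᵇ j)
  ≤ᵇ-suc zero    j = refl
  ≤ᵇ-suc (suc m) j = refl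

count-fewOutside-empty : ∀ {n} (A : Subset n) j → countᵇ (fewOutside A 0 j) (allSubsets n) ≡ 1
count-fewOutside-empty []          j = refl
count-fewOutside-empty {suc n} (a ∷ A) j = trans (countᵇ-allSubsets-suc (fewOutside (a ∷ A) 0 j))
  (cong₂ _+_ (count-fewOutside-empty A j) (countᵇ-none (allSubsets n) (λ S → refl)))

count-fewOutside₀ : ∀ {n} (A : Subset n) r → countᵇ (fewOutside A r 0) (allSubsets n) ≡ choose (card A) r
count-fewOutside₀ []          zero    = refl
count-fewOutside₀ []          (suc r) = refl
count-fewOutside₀ {suc n} (true ∷ A) zero = trans (countᵇ-allSubsets-suc (fewOutside (true ∷ A) 0 0))
  (trans (cong₂ _+_ (count-fewOutside₀ A 0) (countᵇ-none (allSubsets n) (λ S → refl)))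
         (trans (+-identityʳ _) (trans (choose-0 (card A)) (sym (choose-0 (suc (card A)))))))
count-fewOutside₀ {suc n} (true ∷ A) (suc r) = trans (countᵇ-allSubsets-suc (fewOutside (true ∷ A) (suc r) 0))
  (trans (cong₂ _+_ (count-fewOutside₀ A (suc r)) (count-fewOutside₀ A r)) (+-comm (choose (card A) (suc r)) _))
count-fewOutside₀ {suc n} (false ∷ A) zero = trans (countᵇ-allSubsets-suc (fewOutside (false ∷ A) 0 0))
  (trans (cong₂ _+_ (count-fewOutside₀ A 0) (countᵇ-none (allSubsets n) (λ S → refl))) (+-identityʳ _))
count-fewOutside₀ {suc n} (false ∷ A) (suc r) = trans (countᵇ-allSubsets-suc (fewOutside (false ∷ A) (suc r) 0))
  (trans (cong₂ _+_ (count-fewOutside₀ A (suc r)) (countᵇ-none (allSubsets n) (λ S → BoolP.∧-zeroʳ _)))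
         (+-identityʳ _))

count-fewOutside₁ : ∀ {n} (A : Subset n) r →
  countᵇ (fewOutside A (suc r) 1) (allSubsets n) ≡ choose (card A) (suc r) + (n ∸ card A) * choose (card A) r
count-fewOutside₁ []          r = refl
count-fewOutside₁ {suc n} (true ∷ A) zero = trans (countᵇ-allSubsets-suc (fewOutside (true ∷ A) 1 1))
  (trans (cong₂ _+_ (count-fewOutside₁ A 0) (count-fewOutside-empty A 1)) (regroup (card A) (n ∸ card A)))
  where
  regroup : ∀ c m → (choose c 1 + m * choose c 0) + 1 ≡ choose (suc c) 1 + m * choose (suc c) 0
  regroup c m rewrite choose-0 c | choose-1 c = +-comm (c + m * 1) 1
count-fewOutside₁ {suc n} (true ∷ A) (suc r) = trans (countᵇ-allSubsets-suc (fewOutside (true ∷ A) (suc (suc r)) 1))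
  (trans (cong₂ _+_ (count-fewOutside₁ A (suc r)) (count-fewOutside₁ A r))
         (regroup (choose (card A) (suc (suc r))) (choose (card A) (suc r)) (choose (card A) r) (n ∸ card A)))
  where
  regroup : ∀ x y z m → (x + m * y) + (y + m * z) ≡ (y + x) + m * (z + y)
  regroup = solve-∀
count-fewOutside₁ {suc n} (false ∷ A) r = trans (countᵇ-allSubsets-suc (fewOutside (false ∷ A) (suc r) 1))
  (trans (cong₂ _+_ (count-fewOutside₁ A r) newElementOutside)
         (regroup (choose (card A) (suc r)) (choose (card A) r) (n ∸ card A) (+-∸-assoc 1 (card≤ A))))
  where
  newElementOutside : countᵇ (fewOutside (false ∷ A) (suc r) 1 ∘ (true ∷_)) (allSubsets n) ≡ choose (card A) r
  newElementOutside = trans (countᵇ-cong (allSubsets n) (λ S → cong ((card S ≡ᵇ r) ∧_) (≤ᵇ-suc (outside A S) 0)))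
                            (count-fewOutside₀ A r)
  regroup : ∀ x y m {m′} → m′ ≡ suc m → (x + m * y) + y ≡ x + m′ * y
  regroup x y m refl = trans (+-assoc x _ _) (cong (x +_) (+-comm (m * y) y))

-- Berge copies of disjoint unions, assembled from disjoint pieces

split++ : (xs ys : List X) → Fin (length (xs ++ ys)) → Fin (length xs) ⊎ Fin (length ys)
split++ []       ys i       = inj₂ i
split++ (x ∷ xs) ys zero    = inj₁ zero
split++ (x ∷ xs) ys (suc i) with split++ xs ys i
... | inj₁ j = inj₁ (suc j)
... | inj₂ j = inj₂ j

lookup-++-split++ : ∀ (xs ys : List X) i → List.lookup (xs ++ ys) i ≡ [ List.lookup xs , List.lookup ys ]′ (split++ xs ys i)
lookup-++-split++ []       ys i       = refl
lookup-++-split++ (x ∷ xs) ys zero    = refl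
lookup-++-split++ (x ∷ xs) ys (suc i) with split++ xs ys i | lookup-++-split++ xs ys i
... | inj₁ j | e = e
... | inj₂ j | e = e

split++-injective : ∀ (xs ys : List X) {i j} → split++ xs ys i ≡ split++ xs ys j → i ≡ j
split++-injective []       ys refl = refl
split++-injective (x ∷ xs) ys {zero}  {zero}  e = refl
split++-injective (x ∷ xs) ys {zero}  {suc j} e with split++ xs ys j
split++-injective (x ∷ xs) ys {zero}  {suc j} () | inj₁ _
split++-injective (x ∷ xs) ys {zero}  {suc j} () | inj₂ _
split++-injective (x ∷ xs) ys {suc i} {zero}  e with split++ xs ys i
split++-injective (x ∷ xs) ys {suc i} {zero}  () | inj₁ _
split++-injective (x ∷ xs) ys {suc i} {zero}  () | inj₂ _
split++-injective (x ∷ xs) ys {suc i} {suc j} e with split++ xs ys i in ei | split++ xs ys j in ej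
split++-injective (x ∷ xs) ys {suc i} {suc j} refl | inj₁ a | inj₁ .a = cong suc (split++-injective xs ys (trans ei (sym ej)))
split++-injective (x ∷ xs) ys {suc i} {suc j} refl | inj₂ a | inj₂ .a = cong suc (split++-injective xs ys (trans ei (sym ej)))

inject++ˡ : (xs ys : List X) → Fin (length xs) → Fin (length (xs ++ ys))
inject++ˡ (x ∷ xs) ys zero    = zero
inject++ˡ (x ∷ xs) ys (suc j) = suc (inject++ˡ xs ys j)

lookup-inject++ˡ : ∀ (xs ys : List X) j → List.lookup (xs ++ ys) (inject++ˡ xs ys j) ≡ List.lookup xs j
lookup-inject++ˡ (x ∷ xs) ys zero    = refl
lookup-inject++ˡ (x ∷ xs) ys (suc j) = lookup-inject++ˡ xs ys j

raise++ʳ : (xs ys : List X) → Fin (length ys) → Fin (length (xs ++ ys))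
raise++ʳ []       ys j = j
raise++ʳ (x ∷ xs) ys j = suc (raise++ʳ xs ys j)

lookup-raise++ʳ : ∀ (xs ys : List X) j → List.lookup (xs ++ ys) (raise++ʳ xs ys j) ≡ List.lookup ys j
lookup-raise++ʳ []       ys j = refl
lookup-raise++ʳ (x ∷ xs) ys j = lookup-raise++ʳ xs ys j

module _ (g : X → Y) where

  unmap : (xs : List X) → Fin (length (map g xs)) → Fin (length xs)
  unmap (x ∷ xs) zero    = zero
  unmap (x ∷ xs) (suc i) = suc (unmap xs i)

  lookup-map-unmap : ∀ xs i → List.lookup (map g xs) i ≡ g (List.lookup xs (unmap xs i))
  lookup-map-unmap (x ∷ xs) zero    = refl
  lookup-map-unmap (x ∷ xs) (suc i) = lookup-map-unmap xs i

  unmap-injective : ∀ xs {i j} → unmap xs i ≡ unmap xs j → i ≡ j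
  unmap-injective (x ∷ xs) {zero}  {zero}  e = refl
  unmap-injective (x ∷ xs) {suc i} {suc j} e = cong suc (unmap-injective xs (FinP.suc-injective e))

  remap : (xs : List X) → Fin (length xs) → Fin (length (map g xs))
  remap (x ∷ xs) zero    = zero
  remap (x ∷ xs) (suc j) = suc (remap xs j)

  lookup-map-remap : ∀ xs j → List.lookup (map g xs) (remap xs j) ≡ g (List.lookup xs j)
  lookup-map-remap (x ∷ xs) zero    = refl
  lookup-map-remap (x ∷ xs) (suc j) = lookup-map-remap xs j

-- The relabellings of edges used by _∪G_, written with projections so that rewrite recognises them.
liftˡ : ∀ {m₁} m₂ → Fin m₁ × Fin m₁ → Fin (m₁ + m₂) × Fin (m₁ + m₂)
liftˡ m₂ e = (proj₁ e ↑ˡ m₂) , (proj₂ e ↑ˡ m₂)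

liftʳ : ∀ m₁ {m₂} → Fin m₂ × Fin m₂ → Fin (m₁ + m₂) × Fin (m₁ + m₂)
liftʳ m₁ e = (m₁ ↑ʳ proj₁ e) , (m₁ ↑ʳ proj₂ e)

lookup-injective : ∀ {xs : List X} → Unique xs → ∀ {i j} → List.lookup xs i ≡ List.lookup xs j → i ≡ j
lookup-injective {xs = x ∷ xs} (x∉xs ∷ u) {zero}  {zero}  e = refl
lookup-injective {xs = x ∷ xs} (x∉xs ∷ u) {zero}  {suc j} e = ⊥-elim (All.lookup x∉xs (∈-lookup {xs = xs} j) e)
lookup-injective {xs = x ∷ xs} (x∉xs ∷ u) {suc i} {zero}  e = ⊥-elim (All.lookup x∉xs (∈-lookup {xs = xs} i) (sym e))
lookup-injective {xs = x ∷ xs} (x∉xs ∷ u) {suc i} {suc j} e = cong suc (lookup-injective u e)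

↑ˡ≢↑ʳ : ∀ {m₁ m₂} (x : Fin m₁) (y : Fin m₂) → x ↑ˡ m₂ ≢ m₁ ↑ʳ y
↑ˡ≢↑ʳ {m₁} {m₂} x y e = <⇒≢ (begin-strict
  toℕ (x ↑ˡ m₂) ≡⟨ FinP.toℕ-↑ˡ x m₂ ⟩
  toℕ x         <⟨ FinP.toℕ<n x ⟩
  m₁            ≤⟨ m≤m+n m₁ (toℕ y) ⟩
  m₁ + toℕ y    ≡⟨ FinP.toℕ-↑ʳ m₁ y ⟨
  toℕ (m₁ ↑ʳ y) ∎) (cong toℕ e)
  where open ≤-Reasoning

[,]-injective : ∀ {C : Set} {f : X → C} {g : Y → C} → Injective _≡_ _≡_ f → Injective _≡_ _≡_ g →
                (∀ x y → f x ≢ g y) → Injective _≡_ _≡_ [ f , g ]′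
[,]-injective f-inj g-inj f≢g {inj₁ x} {inj₁ y} e = cong inj₁ (f-inj e)
[,]-injective f-inj g-inj f≢g {inj₂ x} {inj₂ y} e = cong inj₂ (g-inj e)
[,]-injective f-inj g-inj f≢g {inj₁ x} {inj₂ y} e = ⊥-elim (f≢g x y e)
[,]-injective f-inj g-inj f≢g {inj₂ x} {inj₁ y} e = ⊥-elim (f≢g y x (sym e))

concatMap-take-drop : ∀ {Z : Set} (f : X → List Z) (g : Y → List Z) ps j ss →
  concatMap [ f , g ]′ (ps ++ map inj₂ (take j ss)) ++ concatMap g (drop j ss) ≡ concatMap [ f , g ]′ ps ++ concatMap g ss
concatMap-take-drop f g ps j ss = begin
  concatMap [ f , g ]′ (ps ++ map inj₂ (take j ss)) ++ concatMap g (drop j ss)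
    ≡⟨ cong (_++ concatMap g (drop j ss)) (concatMap-++ [ f , g ]′ ps (map inj₂ (take j ss))) ⟩
  (concatMap [ f , g ]′ ps ++ concatMap [ f , g ]′ (map inj₂ (take j ss))) ++ concatMap g (drop j ss)
    ≡⟨ ++-assoc (concatMap [ f , g ]′ ps) _ _ ⟩
  concatMap [ f , g ]′ ps ++ (concatMap [ f , g ]′ (map inj₂ (take j ss)) ++ concatMap g (drop j ss))
    ≡⟨ cong (λ z → concatMap [ f , g ]′ ps ++ (z ++ concatMap g (drop j ss))) (concatMap-map [ f , g ]′ inj₂ (take j ss)) ⟩
  concatMap [ f , g ]′ ps ++ (concatMap g (take j ss) ++ concatMap g (drop j ss))
    ≡⟨ cong (concatMap [ f , g ]′ ps ++_) (sym (concatMap-++ g (take j ss) (drop j ss))) ⟩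
  concatMap [ f , g ]′ ps ++ concatMap g (take j ss ++ drop j ss)
    ≡⟨ cong (λ z → concatMap [ f , g ]′ ps ++ concatMap g z) (take++drop≡id j ss) ⟩
  concatMap [ f , g ]′ ps ++ concatMap g ss ∎
  where open ≡-Reasoning

module Berge {r n} (H : RGraph r n) where

  L : ℕ
  L = length (hedges H)

  e : Fin L → Subset n
  e = List.lookup (hedges H)

  -- A Berge copy of F whose vertices lie in V and whose hyperedges lie in Φ; copies living on
  -- disjoint lists combine to a copy of the disjoint union.
  record Embedding (F : Graph) (V : List (Fin n)) (Φ : List (Fin L)) : Set where
    field
      vertex           : Fin (nV F) → Fin n
      vertex-injective : Injective _≡_ _≡_ vertex
      vertex∈V         : ∀ u → vertex u ∈ V
      edge             : Fin (length (edges F)) → Fin L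
      edge-injective   : Injective _≡_ _≡_ edge
      edge∈Φ           : ∀ i → edge i ∈ Φ
      covers           : ∀ i → (vertex (proj₁ (List.lookup (edges F) i)) ∈ₛ e (edge i))
                             × (vertex (proj₂ (List.lookup (edges F) i)) ∈ₛ e (edge i))

  Embedding⇒ContainsBerge : ∀ {F V Φ} → Embedding F V Φ → ContainsBerge H F
  Embedding⇒ContainsBerge emb = vertex , vertex-injective , edge , edge-injective , covers
    where open Embedding emb

  emptyEmbedding : Embedding emptyG [] []
  emptyEmbedding = record
    { vertex = λ () ; vertex-injective = λ {x} → ⊥-elim (FinP.¬Fin0 x) ; vertex∈V = λ ()
    ; edge = λ () ; edge-injective = λ {x} → ⊥-elim (FinP.¬Fin0 x) ; edge∈Φ = λ () ; covers = λ () }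

  unionEmbedding : ∀ {G₁ G₂ V₁ V₂ Φ₁ Φ₂} → Embedding G₁ V₁ Φ₁ → Embedding G₂ V₂ Φ₂ →
    Disjoint V₁ V₂ → Disjoint Φ₁ Φ₂ → Embedding (G₁ ∪G G₂) (V₁ ++ V₂) (Φ₁ ++ Φ₂)
  unionEmbedding {G₁} {G₂} {V₁} {V₂} {Φ₁} {Φ₂} emb₁ emb₂ disjV disjΦ = record
    { vertex = vertex ; vertex-injective = vertex-injective ; vertex∈V = vertex∈V
    ; edge = edge ; edge-injective = edge-injective ; edge∈Φ = edge∈Φ
    ; covers = covers }
    where
    module E₁ = Embedding emb₁
    module E₂ = Embedding emb₂
    m₁ = nV G₁
    m₂ = nV G₂
    Es₁ = map (liftˡ m₂) (edges G₁)
    Es₂ = map (liftʳ m₁) (edges G₂)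

    vertex : Fin (m₁ + m₂) → Fin n
    vertex u = [ E₁.vertex , E₂.vertex ]′ (splitAt m₁ u)

    vertex-injective : Injective _≡_ _≡_ vertex
    vertex-injective {a} {b} eq = begin
      a                        ≡⟨ FinP.join-splitAt m₁ m₂ a ⟨
      join m₁ m₂ (splitAt m₁ a) ≡⟨ cong (join m₁ m₂) (split-injective {splitAt m₁ a} {splitAt m₁ b} eq) ⟩
      join m₁ m₂ (splitAt m₁ b) ≡⟨ FinP.join-splitAt m₁ m₂ b ⟩
      b                        ∎
      where
      open ≡-Reasoning
      split-injective = [,]-injective E₁.vertex-injective E₂.vertex-injective
        (λ x y eq → disjV (E₁.vertex∈V x , subst (_∈ V₂) (sym eq) (E₂.vertex∈V y)))

    vertex∈V : ∀ u → vertex u ∈ V₁ ++ V₂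
    vertex∈V u with splitAt m₁ u
    ... | inj₁ x = ∈-++⁺ˡ (E₁.vertex∈V x)
    ... | inj₂ y = ∈-++⁺ʳ V₁ (E₂.vertex∈V y)

    edge′ : Fin (length Es₁) ⊎ Fin (length Es₂) → Fin L
    edge′ = [ E₁.edge ∘ unmap (liftˡ m₂) (edges G₁) , E₂.edge ∘ unmap (liftʳ m₁) (edges G₂) ]′

    edge : Fin (length (Es₁ ++ Es₂)) → Fin L
    edge i = edge′ (split++ Es₁ Es₂ i)

    edge-injective : Injective _≡_ _≡_ edge
    edge-injective eq = split++-injective Es₁ Es₂
      ([,]-injective (unmap-injective (liftˡ m₂) (edges G₁) ∘ E₁.edge-injective)
                     (unmap-injective (liftʳ m₁) (edges G₂) ∘ E₂.edge-injective)
                     (λ x y eq → disjΦ (E₁.edge∈Φ _ , subst (_∈ Φ₂) (sym eq) (E₂.edge∈Φ _))) eq)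

    edge∈Φ : ∀ i → edge i ∈ Φ₁ ++ Φ₂
    edge∈Φ i with split++ Es₁ Es₂ i
    ... | inj₁ x = ∈-++⁺ˡ (E₁.edge∈Φ _)
    ... | inj₂ y = ∈-++⁺ʳ Φ₁ (E₂.edge∈Φ _)

    covers : ∀ i → (vertex (proj₁ (List.lookup (Es₁ ++ Es₂) i)) ∈ₛ e (edge i))
                 × (vertex (proj₂ (List.lookup (Es₁ ++ Es₂) i)) ∈ₛ e (edge i))
    covers i with split++ Es₁ Es₂ i | lookup-++-split++ Es₁ Es₂ i
    ... | inj₁ j | eq rewrite eq | lookup-map-unmap (liftˡ m₂) (edges G₁) j
                    | FinP.splitAt-↑ˡ m₁ (proj₁ (List.lookup (edges G₁) (unmap (liftˡ m₂) (edges G₁) j))) m₂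
                    | FinP.splitAt-↑ˡ m₁ (proj₂ (List.lookup (edges G₁) (unmap (liftˡ m₂) (edges G₁) j))) m₂
                    = E₁.covers _
    ... | inj₂ j | eq rewrite eq | lookup-map-unmap (liftʳ m₁) (edges G₂) j
                    | FinP.splitAt-↑ʳ m₁ m₂ (proj₁ (List.lookup (edges G₂) (unmap (liftʳ m₁) (edges G₂) j)))
                    | FinP.splitAt-↑ʳ m₁ m₂ (proj₂ (List.lookup (edges G₂) (unmap (liftʳ m₁) (edges G₂) j)))
                    = E₂.covers _

  copiesEmbedding : (G : Graph) {P : Set} (V : P → List (Fin n)) (Φ : P → List (Fin L)) →
    (∀ p → Unique (V p) → Unique (Φ p) → Embedding G (V p) (Φ p)) →
    (ps : List P) → Unique (concatMap V ps) → Unique (concatMap Φ ps) →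
    Embedding (copies (length ps) G) (concatMap V ps) (concatMap Φ ps)
  copiesEmbedding G V Φ emb []       uV uΦ = emptyEmbedding
  copiesEmbedding G V Φ emb (p ∷ ps) uV uΦ with Unique-++⁻ (V p) uV | Unique-++⁻ (Φ p) uΦ
  ... | uVp , uVs , disjV | uΦp , uΦs , disjΦ =
    unionEmbedding (emb p uVp uΦp) (copiesEmbedding G V Φ emb ps uVs uΦs) disjV disjΦ

  record BergeK2 : Set where
    constructor bergeK2
    field
      u v : Fin n
      h   : Fin L
      u∈h : u ∈ₛ e h
      v∈h : v ∈ₛ e h

  record BergeS2 : Set where
    constructor bergeS2
    field
      centre leaf₁ leaf₂ : Fin n
      h₁ h₂              : Fin L
      centre∈h₁ : centre ∈ₛ e h₁
      leaf₁∈h₁  : leaf₁ ∈ₛ e h₁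
      centre∈h₂ : centre ∈ₛ e h₂
      leaf₂∈h₂  : leaf₂ ∈ₛ e h₂

  verticesK2 : BergeK2 → List (Fin n)
  verticesK2 g = BergeK2.u g ∷ BergeK2.v g ∷ []

  hyperedgesK2 : BergeK2 → List (Fin L)
  hyperedgesK2 g = BergeK2.h g ∷ []

  verticesS2 : BergeS2 → List (Fin n)
  verticesS2 g = BergeS2.centre g ∷ BergeS2.leaf₁ g ∷ BergeS2.leaf₂ g ∷ []

  hyperedgesS2 : BergeS2 → List (Fin L)
  hyperedgesS2 g = BergeS2.h₁ g ∷ BergeS2.h₂ g ∷ []

  k2Embedding : ∀ g → Unique (verticesK2 g) → Unique (hyperedgesK2 g) → Embedding K2 (verticesK2 g) (hyperedgesK2 g)
  k2Embedding g uV uΦ = record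
    { vertex = List.lookup (verticesK2 g) ; vertex-injective = lookup-injective uV ; vertex∈V = ∈-lookup
    ; edge = List.lookup (hyperedgesK2 g) ; edge-injective = lookup-injective uΦ ; edge∈Φ = ∈-lookup
    ; covers = λ { zero → BergeK2.u∈h g , BergeK2.v∈h g } }

  s2Embedding : ∀ g → Unique (verticesS2 g) → Unique (hyperedgesS2 g) → Embedding S2 (verticesS2 g) (hyperedgesS2 g)
  s2Embedding g uV uΦ = record
    { vertex = List.lookup (verticesS2 g) ; vertex-injective = lookup-injective uV ; vertex∈V = ∈-lookup
    ; edge = List.lookup (hyperedgesS2 g) ; edge-injective = lookup-injective uΦ ; edge∈Φ = ∈-lookup
    ; covers = λ { zero → centre∈h₁ , leaf₁∈h₁ ; (suc zero) → centre∈h₂ , leaf₂∈h₂ } }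
    where open BergeS2 g

  s2⇒k2Embedding : ∀ g → Unique (verticesS2 g) → Unique (hyperedgesS2 g) → Embedding K2 (verticesS2 g) (hyperedgesS2 g)
  s2⇒k2Embedding g uV uΦ = record
    { vertex = List.lookup (centre ∷ leaf₁ ∷ []) ; vertex-injective = lookup-injective (UniqueP.take⁺ 2 uV)
    ; vertex∈V = λ { zero → here refl ; (suc zero) → there (here refl) }
    ; edge = λ _ → h₁ ; edge-injective = λ { {zero} {zero} _ → refl } ; edge∈Φ = λ _ → here refl
    ; covers = λ { zero → centre∈h₁ , leaf₁∈h₁ } }
    where open BergeS2 g

  EdgePiece : Set
  EdgePiece = BergeK2 ⊎ BergeS2

  verticesE : EdgePiece → List (Fin n)
  verticesE = [ verticesK2 , verticesS2 ]′

  hyperedgesE : EdgePiece → List (Fin L)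
  hyperedgesE = [ hyperedgesK2 , hyperedgesS2 ]′

  edgeEmbedding : ∀ p → Unique (verticesE p) → Unique (hyperedgesE p) → Embedding K2 (verticesE p) (hyperedgesE p)
  edgeEmbedding (inj₁ g) = k2Embedding g
  edgeEmbedding (inj₂ g) = s2⇒k2Embedding g

  containsBerge-pieces : (ps : List EdgePiece) (ss : List BergeS2) →
    Unique (concatMap verticesE ps ++ concatMap verticesS2 ss) →
    Unique (concatMap hyperedgesE ps ++ concatMap hyperedgesS2 ss) →
    ContainsBerge H (M (length ps) ∪G copies (length ss) S2)
  containsBerge-pieces ps ss uV uΦ
    with Unique-++⁻ (concatMap verticesE ps) uV | Unique-++⁻ (concatMap hyperedgesE ps) uΦ
  ... | uVps , uVss , disjV | uΦps , uΦss , disjΦ = Embedding⇒ContainsBerge (unionEmbedding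
        (copiesEmbedding K2 verticesE hyperedgesE edgeEmbedding ps uVps uΦps)
        (copiesEmbedding S2 verticesS2 hyperedgesS2 s2Embedding ss uVss uΦss) disjV disjΦ)

  -- A Berge-S2 contains a Berge-K2, so the first t ∸ |ps| stars may serve as matching edges.
  containsBerge-M∪S2 : (ps : List EdgePiece) (ss : List BergeS2) →
    Unique (concatMap verticesE ps ++ concatMap verticesS2 ss) →
    Unique (concatMap hyperedgesE ps ++ concatMap hyperedgesS2 ss) →
    ∀ t c → length ps ≤ t → t + c ≡ length ps + length ss → ContainsBerge H (M t ∪G copies c S2)
  containsBerge-M∪S2 ps ss uV uΦ t c ps≤t t+c≡ =
    subst (λ (q : ℕ × ℕ) → ContainsBerge H (M (proj₁ q) ∪G copies (proj₂ q) S2)) (cong₂ _,_ length-front length-back)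
      (containsBerge-pieces (ps ++ map inj₂ (take j ss)) (drop j ss)
        (subst Unique (sym (concatMap-take-drop verticesK2 verticesS2 ps j ss)) uV)
        (subst Unique (sym (concatMap-take-drop hyperedgesK2 hyperedgesS2 ps j ss)) uΦ))
    where
    j = t ∸ length ps
    ps+j≡t : length ps + j ≡ t
    ps+j≡t = m+[n∸m]≡n ps≤t
    j+c≡ss : j + c ≡ length ss
    j+c≡ss = +-cancelˡ-≡ (length ps) _ _ (trans (sym (+-assoc (length ps) j c)) (trans (cong (_+ c) ps+j≡t) t+c≡))
    length-front : length (ps ++ map inj₂ (take j ss)) ≡ t
    length-front = begin
      length (ps ++ map inj₂ (take j ss)) ≡⟨ length-++ ps ⟩
      length ps + length (map inj₂ (take j ss)) ≡⟨ cong (length ps +_) (length-map inj₂ (take j ss)) ⟩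
      length ps + length (take j ss) ≡⟨ cong (length ps +_) (length-take j ss) ⟩
      length ps + (j ⊓ length ss) ≡⟨ cong (length ps +_) (m≤n⇒m⊓n≡m (subst (j ≤_) j+c≡ss (m≤m+n j c))) ⟩
      length ps + j ≡⟨ ps+j≡t ⟩
      t ∎
      where open ≡-Reasoning
    length-back : length (drop j ss) ≡ c
    length-back = trans (length-drop j ss) (trans (cong (_∸ j) (sym j+c≡ss)) (m+n∸m≡n j c))

-- Lower bound: all r-sets with at most one vertex outside a fixed (k-1)-set

-- τ(F) ≥ κ: every set of vertices meeting all (non-loop) edges of F contains κ distinct vertices.
EveryCoverHas : Graph → ℕ → Set₁
EveryCoverHas F κ = (C : Fin (nV F) → Set) →
  (∀ i → proj₁ (List.lookup (edges F) i) ≢ proj₂ (List.lookup (edges F) i) →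
         C (proj₁ (List.lookup (edges F) i)) ⊎ C (proj₂ (List.lookup (edges F) i))) →
  Σ (Fin κ → Fin (nV F)) λ w → Injective _≡_ _≡_ w × (∀ j → C (w j))

private
  Fin1-injective : ∀ {X : Set} {w : Fin 1 → X} → Injective _≡_ _≡_ w
  Fin1-injective {x = zero} {zero} _ = refl

everyCoverHas-K2 : EveryCoverHas K2 1
everyCoverHas-K2 C covers with covers zero (λ ())
... | inj₁ c = (λ _ → zero)     , Fin1-injective , λ _ → c
... | inj₂ c = (λ _ → suc zero) , Fin1-injective , λ _ → c

everyCoverHas-S2 : EveryCoverHas S2 1
everyCoverHas-S2 C covers with covers zero (λ ())
... | inj₁ c = (λ _ → zero)     , Fin1-injective , λ _ → c
... | inj₂ c = (λ _ → suc zero) , Fin1-injective , λ _ → c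

everyCoverHas-empty : EveryCoverHas emptyG 0
everyCoverHas-empty C covers = (λ ()) , (λ {x} → ⊥-elim (FinP.¬Fin0 x)) , λ ()

everyCoverHas-∪ : ∀ G₁ G₂ a b → EveryCoverHas G₁ a → EveryCoverHas G₂ b → EveryCoverHas (G₁ ∪G G₂) (a + b)
everyCoverHas-∪ G₁ G₂ a b has₁ has₂ C covers
  with has₁ (λ u → C (u ↑ˡ nV G₂)) covers₁ | has₂ (λ u → C (nV G₁ ↑ʳ u)) covers₂
  where
  m₁ = nV G₁
  m₂ = nV G₂
  Es₁ = map (liftˡ m₂) (edges G₁)
  Es₂ = map (liftʳ m₁) (edges G₂)
  covers₁ : ∀ j → proj₁ (List.lookup (edges G₁) j) ≢ proj₂ (List.lookup (edges G₁) j) →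
            C (proj₁ (List.lookup (edges G₁) j) ↑ˡ m₂) ⊎ C (proj₂ (List.lookup (edges G₁) j) ↑ˡ m₂)
  covers₁ j ne with covers (inject++ˡ Es₁ Es₂ (remap (liftˡ m₂) (edges G₁) j))
  ... | c rewrite lookup-inject++ˡ Es₁ Es₂ (remap (liftˡ m₂) (edges G₁) j) | lookup-map-remap (liftˡ m₂) (edges G₁) j =
        c (λ eq → ne (FinP.↑ˡ-injective m₂ _ _ eq))
  covers₂ : ∀ j → proj₁ (List.lookup (edges G₂) j) ≢ proj₂ (List.lookup (edges G₂) j) →
            C (m₁ ↑ʳ proj₁ (List.lookup (edges G₂) j)) ⊎ C (m₁ ↑ʳ proj₂ (List.lookup (edges G₂) j))
  covers₂ j ne with covers (raise++ʳ Es₁ Es₂ (remap (liftʳ m₁) (edges G₂) j))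
  ... | c rewrite lookup-raise++ʳ Es₁ Es₂ (remap (liftʳ m₁) (edges G₂) j) | lookup-map-remap (liftʳ m₁) (edges G₂) j =
        c (λ eq → ne (FinP.↑ʳ-injective m₁ _ _ eq))
... | w₁ , w₁-inj , w₁∈C | w₂ , w₂-inj , w₂∈C = w ∘ splitAt a , w-injective , w∈C
  where
  w : Fin a ⊎ Fin b → Fin (nV G₁ + nV G₂)
  w = [ (λ x → w₁ x ↑ˡ nV G₂) , (λ y → nV G₁ ↑ʳ w₂ y) ]′
  w-injective : Injective _≡_ _≡_ (w ∘ splitAt a)
  w-injective {x} {y} eq = begin
    x                      ≡⟨ FinP.join-splitAt a b x ⟨
    join a b (splitAt a x) ≡⟨ cong (join a b) ([,]-injective (w₁-inj ∘ FinP.↑ˡ-injective (nV G₂) _ _)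
                                                             (w₂-inj ∘ FinP.↑ʳ-injective (nV G₁) _ _)
                                                             (λ x y → ↑ˡ≢↑ʳ (w₁ x) (w₂ y)) {splitAt a x} {splitAt a y} eq) ⟩
    join a b (splitAt a y) ≡⟨ FinP.join-splitAt a b y ⟩
    y                      ∎
    where open ≡-Reasoning
  w∈C : ∀ j → C (w (splitAt a j))
  w∈C j with splitAt a j
  ... | inj₁ x = w₁∈C x
  ... | inj₂ y = w₂∈C y

everyCoverHas-copies : ∀ G c → EveryCoverHas G 1 → EveryCoverHas (copies c G) c
everyCoverHas-copies G zero    has = everyCoverHas-empty
everyCoverHas-copies G (suc c) has = everyCoverHas-∪ G (copies c G) 1 c has (everyCoverHas-copies G c has)

everyCoverHas-M∪S2 : ∀ t c → EveryCoverHas (M t ∪G copies c S2) (t + c)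
everyCoverHas-M∪S2 t c = everyCoverHas-∪ (M t) (copies c S2) t c
  (everyCoverHas-copies K2 t everyCoverHas-K2) (everyCoverHas-copies S2 c everyCoverHas-S2)

initial : (n a : ℕ) → Subset n
initial n a = tabulate (λ v → toℕ v <ᵇ a)

card-initial : ∀ n a → a ≤ n → card (initial n a) ≡ a
card-initial zero    zero    _        = refl
card-initial (suc n) zero    _        = card-initial n zero z≤n
card-initial (suc n) (suc a) (s≤s le) = cong suc (card-initial n a le)

nearInitial : ∀ n a r → RGraph r n
nearInitial n a r = record
  { hedges   = filterᵇ (fewOutside (initial n a) r 1) (allSubsets n)
  ; distinct = filterᵇ-unique _ (allSubsets-unique n)
  ; uniform  = All.tabulate λ {S} m →
      trans (∣∣≡card S) (proj₁ (fewOutside-sound (initial n a) r 1 S (proj₂ (∈-filterᵇ⁻ _ {allSubsets n} m)))) }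

length-nearInitial : ∀ n a r → a ≤ n →
  length (hedges (nearInitial n a (suc r))) ≡ choose a (suc r) + (n ∸ a) * choose a r
length-nearInitial n a r a≤n = begin
  length (hedges (nearInitial n a (suc r)))        ≡⟨ length-filterᵇ _ (allSubsets n) ⟩
  countᵇ (fewOutside (initial n a) (suc r) 1) (allSubsets n) ≡⟨ count-fewOutside₁ (initial n a) r ⟩
  choose (card (initial n a)) (suc r) + (n ∸ card (initial n a)) * choose (card (initial n a)) r
    ≡⟨ cong (λ c → choose c (suc r) + (n ∸ c) * choose c r) (card-initial n a a≤n) ⟩
  choose a (suc r) + (n ∸ a) * choose a r ∎
  where open ≡-Reasoning

-- A hyperedge has at most one vertex outside the a-set, so the vertices of a Berge copy that land
-- in the a-set cover every edge of M t ∪ c S2; but covering its t + c disjoint components takes t + c vertices.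
nearInitial-free : ∀ n a r t c → a < t + c → BergeFree (nearInitial n a r) (M t ∪G copies c S2)
nearInitial-free n a r t c a<t+c (f , f-inj , φ , φ-inj , covers) = <⇒≱ a<t+c (FinP.injective⇒≤ g-injective)
  where
  F = M t ∪G copies c S2
  Init = initial n a
  In : Fin (nV F) → Set
  In u = toℕ (f u) < a
  lookup-initial-false : ∀ u → ¬ In u → lookup Init (f u) ≡ false
  lookup-initial-false u ¬in with toℕ (f u) <ᵇ a in eq | VecP.lookup∘tabulate (λ v → toℕ v <ᵇ a) (f u)
  ... | false | l = l
  ... | true  | _ = ⊥-elim (¬in (<ᵇ⇒< _ a (≡true⇒T eq)))
  In-covers : ∀ i → proj₁ (List.lookup (edges F) i) ≢ proj₂ (List.lookup (edges F) i) →
              In (proj₁ (List.lookup (edges F) i)) ⊎ In (proj₂ (List.lookup (edges F) i))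
  In-covers i ne with toℕ (f (proj₁ (List.lookup (edges F) i))) <? a | toℕ (f (proj₂ (List.lookup (edges F) i))) <? a
  ... | yes p | _     = inj₁ p
  ... | no _  | yes q = inj₂ q
  ... | no ¬p | no ¬q = ⊥-elim (<⇒≱ (s≤s (s≤s z≤n)) (≤-trans two-outside (proj₂ few)))
    where
    S = List.lookup (hedges (nearInitial n a r)) (φ i)
    few = fewOutside-sound Init r 1 S (proj₂ (∈-filterᵇ⁻ _ {allSubsets n} (∈-lookup {xs = hedges (nearInitial n a r)} (φ i))))
    x = f (proj₁ (List.lookup (edges F) i))
    y = f (proj₂ (List.lookup (edges F) i))
    x-outside : 𝟙 (lookup S x ∧ not (lookup Init x)) ≡ 1
    x-outside rewrite VecP.[]=⇒lookup (proj₁ (covers i)) | lookup-initial-false _ ¬p = refl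
    y-outside : 𝟙 (lookup S y ∧ not (lookup Init y)) ≡ 1
    y-outside rewrite VecP.[]=⇒lookup (proj₂ (covers i)) | lookup-initial-false _ ¬q = refl
    two-outside : 2 ≤ outside Init S
    two-outside = subst (_≤ outside Init S) (cong₂ _+_ x-outside y-outside)
      (twoTerms≤sumFin n (λ v → 𝟙 (lookup S v ∧ not (lookup Init v))) x y (ne ∘ f-inj))
  cover = everyCoverHas-M∪S2 t c In In-covers
  w = proj₁ cover
  g : Fin (t + c) → Fin a
  g j = fromℕ< (proj₂ (proj₂ cover) j)
  g-injective : Injective _≡_ _≡_ g
  g-injective {i} {j} eq = proj₁ (proj₂ cover) (f-inj (FinP.toℕ-injective (begin
    toℕ (f (w i)) ≡⟨ FinP.toℕ-fromℕ< (proj₂ (proj₂ cover) i) ⟨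
    toℕ (g i)     ≡⟨ cong toℕ eq ⟩
    toℕ (g j)     ≡⟨ FinP.toℕ-fromℕ< (proj₂ (proj₂ cover) j) ⟩
    toℕ (f (w j)) ∎)))
    where open ≡-Reasoning

-- Upper bound, step 1: greedy Berge-S2's at vertices of huge degree

module HighDegree {r n} (H : RGraph r n) where

  open Berge H public

  hs : List (Subset n)
  hs = hedges H

  deg : Fin n → ℕ
  deg v = countᵇ (λ S → lookup S v) hs

  _⊆ₗ_ : Subset n → List (Fin n) → Set
  S ⊆ₗ U = ∀ w → lookup S w ≡ true → w ∈ U

  _⊆ₗ?_ : ∀ S U → Dec (S ⊆ₗ U)
  S ⊆ₗ? U = FinP.all? (λ w → (lookup S w BoolP.≟ true) →-dec member? FinP._≟_ w U)

  restrict : (U : List (Fin n)) → Subset n → Subset (length U)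
  restrict U S = tabulate (λ i → lookup S (List.lookup U i))

  count-⊆ₗ : ∀ U → countᵇ (λ S → does (S ⊆ₗ? U)) hs ≤ 2 ^ length U
  count-⊆ₗ U = subst₂ _≤_ (length-filterᵇ p hs) (length-allSubsets (length U))
      (length≤-injectiveOn _≟ₛ_ (restrict U) (filterᵇ-unique p (distinct H)) restrict-injective (λ _ → ∈-allSubsets _))
    where
    p = λ S → does (S ⊆ₗ? U)
    restrict-injective : ∀ {S T} → S ∈ filterᵇ p hs → T ∈ filterᵇ p hs → restrict U S ≡ restrict U T → S ≡ T
    restrict-injective {S} {T} S∈ T∈ eq = subset-ext S T agree
      where
      S⊆U = does-true⇒ (S ⊆ₗ? U) (proj₂ (∈-filterᵇ⁻ p {hs} S∈))
      T⊆U = does-true⇒ (T ⊆ₗ? U) (proj₂ (∈-filterᵇ⁻ p {hs} T∈))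
      agree : ∀ w → lookup S w ≡ lookup T w
      agree w with member? FinP._≟_ w U
      ... | yes w∈U = begin
        lookup S w                              ≡⟨ cong (lookup S) (lookup-index w∈U) ⟩
        lookup S (List.lookup U (index w∈U))    ≡⟨ VecP.lookup∘tabulate _ (index w∈U) ⟨
        lookup (restrict U S) (index w∈U)       ≡⟨ cong (λ R → lookup R (index w∈U)) eq ⟩
        lookup (restrict U T) (index w∈U)       ≡⟨ VecP.lookup∘tabulate _ (index w∈U) ⟩
        lookup T (List.lookup U (index w∈U))    ≡⟨ cong (lookup T) (lookup-index w∈U) ⟨
        lookup T w                              ∎
        where open ≡-Reasoning
      ... | no w∉U with lookup S w in Sw | lookup T w in Tw
      ...   | true  | _     = ⊥-elim (w∉U (S⊆U w Sw))
      ...   | false | true  = ⊥-elim (w∉U (T⊆U w Tw))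
      ...   | false | false = refl

  count-∈ : ∀ (Ss : List (Subset n)) → countᵇ (λ S → does (member? _≟ₛ_ S Ss)) hs ≤ length Ss
  count-∈ Ss = subst (_≤ length Ss) (length-filterᵇ _ hs)
    (Unique⇒length≤ _≟ₛ_ (filterᵇ-unique _ (distinct H)) (λ m → does-true⇒ (member? _≟ₛ_ _ Ss) (proj₂ (∈-filterᵇ⁻ _ {hs} m))))

  Escape : Fin n → List (Fin n) → List (Fin L) → Set
  Escape b U Φ = Σ (Fin L) λ h → (h ∉ Φ) × (b ∈ₛ e h) × Σ (Fin n) λ w → (w ∉ U) × (w ∈ₛ e h)

  escape? : ∀ b U Φ → Dec (Escape b U Φ)
  escape? b U Φ = FinP.any? λ h → ¬? (member? FinP._≟_ h Φ) ×-dec (b ∈ₛ? e h) ×-dec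
                                  FinP.any? (λ w → ¬? (member? FinP._≟_ w U) ×-dec (w ∈ₛ? e h))

  -- Hyperedges through b that do not escape are either listed in Φ or lie inside U.
  escape : ∀ b U Φ → length Φ + 2 ^ length U < deg b → Escape b U Φ
  escape b U Φ lt with escape? b U Φ
  ... | yes esc = esc
  ... | no ¬esc = ⊥-elim (<⇒≱ lt (begin
    deg b ≤⟨ countᵇ-≤-∨ _ _ _ hs listedOrInside ⟩
    countᵇ listed hs + countᵇ (λ S → does (S ⊆ₗ? U)) hs
      ≤⟨ +-mono-≤ (subst (countᵇ listed hs ≤_) (length-map e Φ) (count-∈ (map e Φ))) (count-⊆ₗ U) ⟩
    length Φ + 2 ^ length U ∎))
    where
    open ≤-Reasoning
    listed = λ S → does (member? _≟ₛ_ S (map e Φ))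
    listedOrInside : ∀ S → S ∈ hs → lookup S b ≡ true → listed S ≡ true ⊎ does (S ⊆ₗ? U) ≡ true
    listedOrInside S S∈hs Sb with member? FinP._≟_ (index S∈hs) Φ
    ... | yes h∈Φ = inj₁ (dec-true (member? _≟ₛ_ S (map e Φ)) (subst (_∈ map e Φ) (sym (lookup-index S∈hs)) (∈-map⁺ e h∈Φ)))
    ... | no  h∉Φ = inj₂ (dec-true (S ⊆ₗ? U) S⊆U)
      where
      S⊆U : S ⊆ₗ U
      S⊆U w Sw with member? FinP._≟_ w U
      ... | yes w∈U = w∈U
      ... | no  w∉U = ⊥-elim (¬esc (index S∈hs , h∉Φ , on b Sb , w , w∉U , on w Sw))
        where
        on : ∀ v → lookup S v ≡ true → v ∈ₛ e (index S∈hs)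
        on v Sv = VecP.lookup⇒[]= v _ (subst (λ T → lookup T v ≡ true) (lookup-index S∈hs) Sv)

  module _ (K : ℕ) where

    Huge : Fin n → Set
    Huge c = K + 2 ^ K ≤ deg c

    record FreshStar (c : Fin n) (U : List (Fin n)) (Φ : List (Fin L)) : Set where
      field
        star   : BergeS2
        centre : BergeS2.centre star ≡ c
        leaf₁∉ : BergeS2.leaf₁ star ∉ U
        leaf₂∉ : BergeS2.leaf₂ star ∉ BergeS2.leaf₁ star ∷ U
        h₁∉    : BergeS2.h₁ star ∉ Φ
        h₂∉    : BergeS2.h₂ star ∉ BergeS2.h₁ star ∷ Φ

    private
      room : ∀ {c a b} → Huge c → suc a ≤ K → b ≤ K → a + 2 ^ b < deg c
      room huge a<K b≤K = ≤-trans (+-mono-≤ a<K (^-monoʳ-≤ 2 b≤K)) huge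

    freshStar : ∀ c U Φ → suc (length U) ≤ K → suc (suc (length Φ)) ≤ K → Huge c → FreshStar c U Φ
    freshStar c U Φ U<K Φ+2≤K huge
      with escape c U Φ (room huge (≤-trans (n≤1+n _) Φ+2≤K) (≤-trans (n≤1+n _) U<K))
    ... | h₁ , h₁∉Φ , c∈h₁ , w₁ , w₁∉U , w₁∈h₁
      with escape c (w₁ ∷ U) (h₁ ∷ Φ) (room huge Φ+2≤K U<K)
    ... | h₂ , h₂∉ , c∈h₂ , w₂ , w₂∉ , w₂∈h₂ = record
      { star = bergeS2 c w₁ w₂ h₁ h₂ c∈h₁ w₁∈h₁ c∈h₂ w₂∈h₂
      ; centre = refl ; leaf₁∉ = w₁∉U ; leaf₂∉ = w₂∉ ; h₁∉ = h₁∉Φ ; h₂∉ = h₂∉ }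

    fresh-vertices : ∀ {c Xs Φ} (f : FreshStar c (c ∷ Xs) Φ) → All (c ≢_) Xs → Unique Xs →
      Unique (Xs ++ verticesS2 (FreshStar.star f))
    fresh-vertices {c} {Xs} f c∉Xs uXs = UniqueP.++⁺ uXs (centre-fresh ∷ leaf₁-fresh ∷ [] ∷ []) disjoint
      where
      open FreshStar f
      open BergeS2 star using (leaf₁; leaf₂)
      centre-fresh : All (BergeS2.centre star ≢_) (leaf₁ ∷ leaf₂ ∷ [])
      centre-fresh = AllP.¬Any⇒All¬ _ λ where
        (here e)         → leaf₁∉ (here (trans (sym e) centre))
        (there (here e)) → leaf₂∉ (there (here (trans (sym e) centre)))
      leaf₁-fresh : All (leaf₁ ≢_) (leaf₂ ∷ [])
      leaf₁-fresh = AllP.¬Any⇒All¬ _ λ where (here e) → leaf₂∉ (here (sym e))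
      disjoint : Disjoint Xs (verticesS2 star)
      disjoint (m , here refl)                 = All.lookup c∉Xs (subst (_∈ Xs) centre m) refl
      disjoint (m , there (here refl))         = leaf₁∉ (there m)
      disjoint (m , there (there (here refl))) = leaf₂∉ (there (there m))

    fresh-hyperedges : ∀ {c U Φ} (f : FreshStar c U Φ) → Unique Φ → Unique (Φ ++ hyperedgesS2 (FreshStar.star f))
    fresh-hyperedges {Φ = Φ} f uΦ =
      UniqueP.++⁺ uΦ ((AllP.¬Any⇒All¬ _ λ where (here e) → h₂∉ (here (sym e))) ∷ [] ∷ []) disjoint
      where
      open FreshStar f
      disjoint : Disjoint Φ (hyperedgesS2 star)
      disjoint (m , here refl)         = h₁∉ m
      disjoint (m , there (here refl)) = h₂∉ (there m)

    greedyStars : ∀ Cs → All Huge Cs → ∀ V Φ → Unique (Cs ++ V) → Unique Φ →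
      length V + 3 * length Cs ≤ K → length Φ + 2 * length Cs ≤ K →
      Σ (List BergeS2) λ ss → length ss ≡ length Cs
        × Unique (V ++ concatMap verticesS2 ss) × Unique (Φ ++ concatMap hyperedgesS2 ss)
    greedyStars [] _ V Φ uV uΦ _ _ =
      [] , refl , subst Unique (sym (++-identityʳ V)) uV , subst Unique (sym (++-identityʳ Φ)) uΦ
    greedyStars (c ∷ Cs) (huge ∷ huges) V Φ (c∉ ∷ uV) uΦ V-room Φ-room =
      star ∷ ss , cong suc length-ss , subst Unique (++-assoc V _ _) uV-ss , subst Unique (++-assoc Φ _ _) uΦ-ss
      where
      x = length Cs
      U-room : suc (length (c ∷ Cs ++ V)) ≤ K
      U-room = subst (λ z → suc (suc z) ≤ K) (sym (length-++ Cs))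
        (≤-trans (m≤m+n _ _) (subst (_≤ K) (split (length V) x) V-room))
        where
        split : ∀ v x → v + 3 * suc x ≡ suc (suc (x + v)) + suc (x + x)
        split = solve-∀
      Φ-room-now : suc (suc (length Φ)) ≤ K
      Φ-room-now = ≤-trans (m≤m+n _ _) (subst (_≤ K) (split (length Φ) x) Φ-room)
        where
        split : ∀ p x → p + 2 * suc x ≡ suc (suc p) + 2 * x
        split = solve-∀
      fresh = freshStar c (c ∷ Cs ++ V) Φ U-room Φ-room-now huge
      star = FreshStar.star fresh
      V-room-rest : length (V ++ verticesS2 star) + 3 * x ≤ K
      V-room-rest = subst (_≤ K) (sym (trans (cong (_+ 3 * x) (length-++ V)) (split (length V) x))) V-room
        where
        split : ∀ v x → v + 3 + 3 * x ≡ v + 3 * suc x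
        split = solve-∀
      Φ-room-rest : length (Φ ++ hyperedgesS2 star) + 2 * x ≤ K
      Φ-room-rest = subst (_≤ K) (sym (trans (cong (_+ 2 * x) (length-++ Φ)) (split (length Φ) x))) Φ-room
        where
        split : ∀ p x → p + 2 + 2 * x ≡ p + 2 * suc x
        split = solve-∀
      rest = greedyStars Cs huges (V ++ verticesS2 star) (Φ ++ hyperedgesS2 star)
               (subst Unique (++-assoc Cs V _) (fresh-vertices fresh c∉ uV)) (fresh-hyperedges fresh uΦ)
               V-room-rest Φ-room-rest
      ss = proj₁ rest
      length-ss = proj₁ (proj₂ rest)
      uV-ss = proj₁ (proj₂ (proj₂ rest))
      uΦ-ss = proj₂ (proj₂ (proj₂ rest))

-- Upper bound, step 2: many huge vertices force the extremal structure

-- Since p ≥ 1, a surplus of m pays for all terms that do not grow with m.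
absorb-lower-order : ∀ L a b c d p w m δ →
  2 * L ≤ 2 * (a + (m + δ) * b) + 2 * w + (m + δ) * p → b + p ≤ d → 1 ≤ p →
  2 * a + 2 * δ * b + 2 * w + δ * p ≤ m → L ≤ c + m * d
absorb-lower-order L a b c d p w m δ 2L≤ b+p≤d 1≤p small = *-cancelˡ-≤ 2 (begin
  2 * L                                                       ≤⟨ 2L≤ ⟩
  2 * (a + (m + δ) * b) + 2 * w + (m + δ) * p                 ≡⟨ regroup a b w m δ p ⟩
  (2 * m * b + m * p) + (2 * a + 2 * δ * b + 2 * w + δ * p)   ≤⟨ +-monoʳ-≤ (2 * m * b + m * p) small ⟩
  (2 * m * b + m * p) + m                                     ≤⟨ +-monoʳ-≤ (2 * m * b + m * p) (≤-trans (≤-reflexive (sym (*-identityʳ m))) (*-monoʳ-≤ m 1≤p)) ⟩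
  (2 * m * b + m * p) + m * p                                 ≡⟨ factor m b p ⟩
  2 * m * (b + p)                                             ≤⟨ *-monoʳ-≤ (2 * m) b+p≤d ⟩
  2 * m * d                                                   ≡⟨ *-assoc 2 m d ⟩
  2 * (m * d)                                                 ≤⟨ *-monoʳ-≤ 2 (m≤n+m (m * d) c) ⟩
  2 * (c + m * d)                                             ∎)
  where
  open ≤-Reasoning
  regroup : ∀ a b w m δ p → 2 * (a + (m + δ) * b) + 2 * w + (m + δ) * p ≡ (2 * m * b + m * p) + (2 * a + 2 * δ * b + 2 * w + δ * p)
  regroup = solve-∀
  factor : ∀ m b p → 2 * m * b + m * p + m * p ≡ 2 * m * (b + p)
  factor = solve-∀

-- Dominates 2 C(s,r) + 2δ C(s,r-1) + 2|W| D + δ max(C(s,r-2),1), using s, δ ≤ k, |W| ≤ 2rk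
-- and binomials over an s-set being at most 2^k.
lowerOrder : ℕ → ℕ → ℕ
lowerOrder k r₀ = 2 * 2 ^ k + 2 * k * 2 ^ k + 2 * (k * (2 * suc r₀) * (8 * k + 2 ^ (8 * k))) + k * 2 ^ k

threshold : ℕ → ℕ → ℕ
threshold k r₀ = lowerOrder k r₀ + k

module UpperBound {r₀ n} (H : RGraph (suc r₀) n) (k t : ℕ) (1≤t : 1 ≤ t) (t≤k : t ≤ k)
                  (free : BergeFree H (M t ∪G copies (k ∸ t) S2)) where

  open HighDegree H

  K : ℕ
  K = 8 * k

  D : ℕ
  D = K + 2 ^ K

  3k≤K : 3 * k ≤ K
  3k≤K = *-monoˡ-≤ k {3} {8} (s≤s (s≤s (s≤s z≤n)))

  huge? : Fin n → Bool
  huge? v = D ≤ᵇ deg v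

  Big : List (Fin n)
  Big = filterᵇ huge? (allFin n)

  Big-unique : Unique Big
  Big-unique = filterᵇ-unique huge? (UniqueP.allFin⁺ n)

  Big-huge : ∀ {v} → v ∈ Big → Huge K v
  Big-huge m = ≤ᵇ⇒≤ D _ (≡true⇒T (proj₂ (∈-filterᵇ⁻ huge? {allFin n} m)))

  s : ℕ
  s = length Big

  uniform′ : All (λ S → card S ≡ suc r₀) hs
  uniform′ = All.map (λ {S} eq → trans (sym (∣∣≡card S)) eq) (uniform H)

  card-e : ∀ i → card (e i) ≡ suc r₀
  card-e i = All.lookup uniform′ (∈-lookup {xs = hs} i)

  length≤fewOutside : ∀ (A : Subset n) → (∀ S → S ∈ hs → outside A S ≤ 1) →
    length hs ≤ choose (card A) (suc r₀) + (n ∸ card A) * choose (card A) r₀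
  length≤fewOutside A few = subst (length hs ≤_) (count-fewOutside₁ A r₀)
    (length≤countᵇ _≟ₛ_ (fewOutside A (suc r₀) 1) hs (allSubsets n) (distinct H)
      (All.tabulate (λ {S} m → fewOutside-complete A (suc r₀) 1 S (All.lookup uniform′ m) (few S m))) (λ {S} _ → ∈-allSubsets S))

  twoOutside : ∀ (A : Subset n) S → ¬ (outside A S ≤ 1) → Σ (Fin n) λ x → Σ (Fin n) λ y → x ≢ y ×
    (lookup S x ≡ true × lookup A x ≡ false) × (lookup S y ≡ true × lookup A y ≡ false)
  twoOutside A S ¬few with ∃₂-true-of-2≤count n (λ v → lookup S v ∧ not (lookup A v)) (≰⇒> ¬few)
  ... | x , y , x≢y , px , py = x , y , x≢y , split px , split py
    where
    split : ∀ {a b} → a ∧ not b ≡ true → a ≡ true × b ≡ false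
    split {true} {false} _ = refl , refl

  ∈ₛ-index : ∀ {S v} (S∈hs : S ∈ hs) → lookup S v ≡ true → v ∈ₛ e (index S∈hs)
  ∈ₛ-index {S} {v} S∈hs Sv = VecP.lookup⇒[]= v _ (subst (λ T → lookup T v ≡ true) (lookup-index S∈hs) Sv)

  -- A hyperedge with two vertices outside k-1 huge vertices gives the first matching edge;
  -- the huge vertices then carry k-1 further disjoint Berge-S2's.
  edge+stars : ∀ B → Unique B → All (Huge K) B → length B ≡ k ∸ 1 →
    ∀ {S x y} → S ∈ hs → x ≢ y → x ∉ B → y ∉ B → lookup S x ≡ true → lookup S y ≡ true →
    ContainsBerge H (M t ∪G copies (k ∸ t) S2)
  edge+stars B B-unique B-huge length-B {S} {x} {y} S∈hs x≢y x∉B y∉B Sx Sy =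
    containsBerge-M∪S2 (inj₁ edge ∷ []) stars
      (proj₁ (proj₂ (proj₂ greedy))) (proj₂ (proj₂ (proj₂ greedy))) t (k ∸ t) 1≤t t+[k∸t]≡1+stars
    where
    edge : BergeK2
    edge = bergeK2 x y (index S∈hs) (∈ₛ-index S∈hs Sx) (∈ₛ-index S∈hs Sy)
    B++xy-unique : Unique (B ++ x ∷ y ∷ [])
    B++xy-unique = UniqueP.++⁺ B-unique ((x≢y ∷ []) ∷ [] ∷ []) λ where
      (m , here refl)         → x∉B m
      (m , there (here refl)) → y∉B m
    room : ∀ {a b} → a ≤ 3 → b ≤ 3 → a + b * length B ≤ K
    room {a} {b} a≤3 b≤3 = begin
      a + b * length B       ≤⟨ +-mono-≤ a≤3 (*-monoˡ-≤ (length B) b≤3) ⟩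
      3 + 3 * length B       ≡⟨ cong (λ z → 3 + 3 * z) length-B ⟩
      3 + 3 * (k ∸ 1)        ≡⟨ *-distribˡ-+ 3 1 (k ∸ 1) ⟨
      3 * (1 + (k ∸ 1))      ≡⟨ cong (3 *_) (m+[n∸m]≡n (≤-trans 1≤t t≤k)) ⟩
      3 * k                  ≤⟨ 3k≤K ⟩
      K                      ∎
      where open ≤-Reasoning
    greedy = greedyStars K B B-huge (x ∷ y ∷ []) (index S∈hs ∷ []) B++xy-unique ([] ∷ [])
               (room (n≤1+n 2) ≤-refl) (room (s≤s z≤n) (n≤1+n 2))
    stars = proj₁ greedy
    t+[k∸t]≡1+stars : t + (k ∸ t) ≡ 1 + length stars
    t+[k∸t]≡1+stars = begin
      t + (k ∸ t)   ≡⟨ m+[n∸m]≡n t≤k ⟩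
      k             ≡⟨ m+[n∸m]≡n (≤-trans 1≤t t≤k) ⟨
      1 + (k ∸ 1)   ≡⟨ cong (1 +_) (trans (sym length-B) (sym (proj₁ (proj₂ greedy)))) ⟩
      1 + length stars ∎
      where open ≡-Reasoning

  manyBig⇒bound : k ∸ 1 ≤ s → length hs ≤ choose (k ∸ 1) (suc r₀) + (n ∸ (k ∸ 1)) * choose (k ∸ 1) r₀
  manyBig⇒bound k-1≤s = subst (length hs ≤_) (cong (λ c → choose c (suc r₀) + (n ∸ c) * choose c r₀) card-A)
                          (length≤fewOutside A fewOutsideA)
    where
    B = take (k ∸ 1) Big
    B-unique : Unique B
    B-unique = UniqueP.take⁺ (k ∸ 1) Big-unique
    length-B : length B ≡ k ∸ 1
    length-B = trans (length-take (k ∸ 1) Big) (m≤n⇒m⊓n≡m k-1≤s)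
    A = fromList B
    card-A : card A ≡ k ∸ 1
    card-A = trans (card-fromList B B-unique) length-B
    ∉B : ∀ {x} → lookup A x ≡ false → x ∉ B
    ∉B {x} Ax = does-false⇒¬ (member? FinP._≟_ x B) (trans (sym (lookup-fromList B x)) Ax)
    fewOutsideA : ∀ S → S ∈ hs → outside A S ≤ 1
    fewOutsideA S S∈hs with outside A S ≤? 1
    ... | yes few = few
    ... | no ¬few with twoOutside A S ¬few
    ...   | x , y , x≢y , (Sx , Ax) , (Sy , Ay) =
      ⊥-elim (free (edge+stars B B-unique (AllP.take⁺ (k ∸ 1) (All.tabulate Big-huge)) length-B
                      S∈hs x≢y (∉B Ax) (∉B Ay) Sx Sy))

  BigSet : Subset n
  BigSet = fromList Big

  notBig⇒deg<D : ∀ v → lookup BigSet v ≡ false → deg v < D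
  notBig⇒deg<D v notBig with D ≤? deg v
  ... | no  D≰deg = ≰⇒> D≰deg
  ... | yes D≤deg = ⊥-elim (does-false⇒¬ (member? FinP._≟_ v Big) (trans (sym (lookup-fromList Big v)) notBig)
                      (∈-filterᵇ⁺ huge? (∈-allFin v) (T⇒≡true (≤⇒≤ᵇ D≤deg))))

  Big⇒lookup : ∀ {v} → v ∈ Big → lookup BigSet v ≡ true
  Big⇒lookup {v} m = trans (lookup-fromList Big v) (dec-true (member? FinP._≟_ v Big) m)

  -- Upper bound, step 3: few huge vertices

  Avoids : Subset n → Subset n → Set
  Avoids W S = ∀ w → lookup S w ≡ true → lookup W w ≡ false

  avoids? : ∀ W S → Dec (Avoids W S)
  avoids? W S = FinP.all? (λ w → (lookup S w BoolP.≟ true) →-dec (lookup W w BoolP.≟ false))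

  Good : Subset n → Fin L → Set
  Good W i = 2 ≤ outside BigSet (e i) × Avoids W (e i)

  good? : ∀ W i → Dec (Good W i)
  good? W i = (2 ≤? outside BigSet (e i)) ×-dec avoids? W (e i)

  Cherry : Subset n → Set
  Cherry W = Σ (Fin L) λ i → Σ (Fin L) λ j → (i ≢ j) × Good W i × Good W j ×
    Σ (Fin n) λ v → Σ (Fin n) λ x → Σ (Fin n) λ y →
      (lookup BigSet v ≡ false × lookup BigSet x ≡ false × lookup BigSet y ≡ false) ×
      (v ≢ x × v ≢ y × x ≢ y) ×
      (v ∈ₛ e i × x ∈ₛ e i × v ∈ₛ e j × y ∈ₛ e j)

  cherry? : ∀ W → Dec (Cherry W)
  cherry? W = FinP.any? λ i → FinP.any? λ j → ¬? (i FinP.≟ j) ×-dec good? W i ×-dec good? W j ×-dec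
    FinP.any? λ v → FinP.any? λ x → FinP.any? λ y →
      ((lookup BigSet v BoolP.≟ false) ×-dec (lookup BigSet x BoolP.≟ false) ×-dec (lookup BigSet y BoolP.≟ false)) ×-dec
      (¬? (v FinP.≟ x) ×-dec ¬? (v FinP.≟ y) ×-dec ¬? (x FinP.≟ y)) ×-dec
      ((v ∈ₛ? e i) ×-dec (x ∈ₛ? e i) ×-dec (v ∈ₛ? e j) ×-dec (y ∈ₛ? e j))

  R : ℕ
  R = 2 * suc r₀

  NotBig : Subset n → Set
  NotBig W = ∀ v → lookup W v ≡ true → lookup BigSet v ≡ false

  -- W collects the small vertices of the hyperedges of the cherries found so far.
  record Invariant (W : Subset n) (stars : List BergeS2) : Set where
    field
      W-notBig          : NotBig W
      card-W            : card W ≤ length stars * R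
      vertices-unique   : Unique (concatMap verticesS2 stars)
      hyperedges-unique : Unique (concatMap hyperedgesS2 stars)
      vertices⊆W        : ∀ {v} → v ∈ concatMap verticesS2 stars → lookup W v ≡ true
      hyperedges-meet-W : ∀ {h} → h ∈ concatMap hyperedgesS2 stars → Σ (Fin n) λ v → lookup (e h) v ≡ true × lookup W v ≡ true

  invariant-[] : Invariant (replicate n false) []
  invariant-[] = record
    { W-notBig = λ v W-v → ⊥-elim (true≢false W-v (VecP.lookup-replicate v false))
    ; card-W = ≤-reflexive (card-replicate-false n)
    ; vertices-unique = [] ; hyperedges-unique = [] ; vertices⊆W = λ () ; hyperedges-meet-W = λ () }

  extend : Subset n → Fin L → Fin L → Subset n
  extend W i j = tabulate (λ w → lookup W w ∨ ((lookup (e i) w ∨ lookup (e j) w) ∧ not (lookup BigSet w)))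

  lookup-extend : ∀ W i j w → lookup (extend W i j) w ≡ (lookup W w ∨ ((lookup (e i) w ∨ lookup (e j) w) ∧ not (lookup BigSet w)))
  lookup-extend W i j w = VecP.lookup∘tabulate _ w

  extend-old : ∀ W i j w → lookup W w ≡ true → lookup (extend W i j) w ≡ true
  extend-old W i j w Ww rewrite lookup-extend W i j w | Ww = refl

  extend-newˡ : ∀ W i j w → lookup (e i) w ≡ true → lookup BigSet w ≡ false → lookup (extend W i j) w ≡ true
  extend-newˡ W i j w iw bw rewrite lookup-extend W i j w | iw | bw = BoolP.∨-zeroʳ _

  extend-newʳ : ∀ W i j w → lookup (e j) w ≡ true → lookup BigSet w ≡ false → lookup (extend W i j) w ≡ true
  extend-newʳ W i j w jw bw rewrite lookup-extend W i j w | jw | bw | BoolP.∨-zeroʳ (lookup (e i) w) = BoolP.∨-zeroʳ _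

  extend-notBig : ∀ W i j → NotBig W → NotBig (extend W i j)
  extend-notBig W i j W-notBig w p rewrite lookup-extend W i j w with lookup W w in Ww
  ... | true  = W-notBig w Ww
  ... | false with lookup BigSet w
  ...   | false = refl
  ...   | true  = ⊥-elim (true≢false p (BoolP.∧-zeroʳ _))

  card-extend : ∀ W i j → card (extend W i j) ≤ card W + R
  card-extend W i j = begin
    card (extend W i j) ≤⟨ sumFin-mono n pointwise ⟩
    sumFin n (λ w → 𝟙 (lookup W w) + (𝟙 (lookup (e i) w) + 𝟙 (lookup (e j) w)))
      ≡⟨ trans (sumFin-+ n _ _) (cong (card W +_) (sumFin-+ n _ _)) ⟩
    card W + (card (e i) + card (e j)) ≡⟨ cong (λ z → card W + z) (cong₂ _+_ (card-e i) (card-e j)) ⟩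
    card W + (suc r₀ + suc r₀) ≡⟨ cong (card W +_) (cong (suc r₀ +_) (sym (+-identityʳ (suc r₀)))) ⟩
    card W + R ∎
    where
    open ≤-Reasoning
    𝟙-∨∧ : ∀ a b c d → 𝟙 (a ∨ ((b ∨ c) ∧ d)) ≤ 𝟙 a + (𝟙 b + 𝟙 c)
    𝟙-∨∧ true  b     c     d     = s≤s z≤n
    𝟙-∨∧ false true  c     true  = s≤s z≤n
    𝟙-∨∧ false true  c     false = z≤n
    𝟙-∨∧ false false true  true  = s≤s z≤n
    𝟙-∨∧ false false true  false = z≤n
    𝟙-∨∧ false false false d     = ≤-reflexive (cong 𝟙 (BoolP.∧-zeroˡ d))
    pointwise : ∀ w → 𝟙 (lookup (extend W i j) w) ≤ 𝟙 (lookup W w) + (𝟙 (lookup (e i) w) + 𝟙 (lookup (e j) w))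
    pointwise w rewrite lookup-extend W i j w = 𝟙-∨∧ (lookup W w) (lookup (e i) w) (lookup (e j) w) (not (lookup BigSet w))

  step : ∀ {W stars} → Invariant W stars → (c : Cherry W) →
    Σ BergeS2 λ star → Invariant (extend W (proj₁ c) (proj₁ (proj₂ c))) (star ∷ stars)
  step {W} {stars} inv (i , j , i≢j , (_ , avoids-i) , (_ , avoids-j) , v , x , y ,
                        (v-small , x-small , y-small) , (v≢x , v≢y , x≢y) , (v∈i , x∈i , v∈j , y∈j)) =
    star , record
      { W-notBig = extend-notBig W i j W-notBig
      ; card-W = ≤-trans (card-extend W i j) (≤-trans (≤-reflexive (+-comm (card W) R)) (+-monoʳ-≤ R card-W))
      ; vertices-unique = UniqueP.++⁺ ((v≢x ∷ v≢y ∷ []) ∷ (x≢y ∷ []) ∷ [] ∷ []) vertices-unique vertices-disjoint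
      ; hyperedges-unique = UniqueP.++⁺ ((i≢j ∷ []) ∷ [] ∷ []) hyperedges-unique hyperedges-disjoint
      ; vertices⊆W = vertices⊆W′
      ; hyperedges-meet-W = hyperedges-meet-W′ }
    where
    open Invariant inv
    star = bergeS2 v x y i j v∈i x∈i v∈j y∈j
    W′ = extend W i j
    in-i : ∀ {w} → w ∈ₛ e i → lookup W w ≡ false
    in-i {w} w∈i = avoids-i w (VecP.[]=⇒lookup w∈i)
    in-j : ∀ {w} → w ∈ₛ e j → lookup W w ≡ false
    in-j {w} w∈j = avoids-j w (VecP.[]=⇒lookup w∈j)
    vertices-disjoint : Disjoint (v ∷ x ∷ y ∷ []) (concatMap verticesS2 stars)
    vertices-disjoint (here refl , m)                 = true≢false (vertices⊆W m) (in-i v∈i)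
    vertices-disjoint (there (here refl) , m)         = true≢false (vertices⊆W m) (in-i x∈i)
    vertices-disjoint (there (there (here refl)) , m) = true≢false (vertices⊆W m) (in-j y∈j)
    hyperedges-disjoint : Disjoint (i ∷ j ∷ []) (concatMap hyperedgesS2 stars)
    hyperedges-disjoint (here refl , m) with hyperedges-meet-W m
    ... | u , iu , Wu = true≢false Wu (avoids-i u iu)
    hyperedges-disjoint (there (here refl) , m) with hyperedges-meet-W m
    ... | u , ju , Wu = true≢false Wu (avoids-j u ju)
    vertices⊆W′ : ∀ {w} → w ∈ concatMap verticesS2 (star ∷ stars) → lookup W′ w ≡ true
    vertices⊆W′ (here refl)                 = extend-newˡ W i j v (VecP.[]=⇒lookup v∈i) v-small
    vertices⊆W′ (there (here refl))         = extend-newˡ W i j x (VecP.[]=⇒lookup x∈i) x-small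
    vertices⊆W′ (there (there (here refl))) = extend-newʳ W i j y (VecP.[]=⇒lookup y∈j) y-small
    vertices⊆W′ (there (there (there m)))   = extend-old W i j _ (vertices⊆W m)
    hyperedges-meet-W′ : ∀ {h} → h ∈ concatMap hyperedgesS2 (star ∷ stars) →
                         Σ (Fin n) λ u → lookup (e h) u ≡ true × lookup W′ u ≡ true
    hyperedges-meet-W′ (here refl)         = v , VecP.[]=⇒lookup v∈i , extend-newˡ W i j v (VecP.[]=⇒lookup v∈i) v-small
    hyperedges-meet-W′ (there (here refl)) = v , VecP.[]=⇒lookup v∈j , extend-newʳ W i j v (VecP.[]=⇒lookup v∈j) v-small
    hyperedges-meet-W′ (there (there m)) with hyperedges-meet-W m
    ... | u , hu , Wu = u , hu , extend-old W i j u Wu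

  ManyStars : ℕ → Set
  ManyStars goal = Σ (List BergeS2) λ stars → length stars ≡ goal
    × Unique (concatMap verticesS2 stars) × Unique (concatMap hyperedgesS2 stars)
    × (∀ {v} → v ∈ concatMap verticesS2 stars → lookup BigSet v ≡ false)

  NoCherry : ℕ → Set
  NoCherry goal = Σ (Subset n) λ W → NotBig W × card W ≤ goal * R × ¬ Cherry W

  collectCherries : ∀ fuel W stars → Invariant W stars → ManyStars (length stars + fuel) ⊎ NoCherry (length stars + fuel)
  collectCherries zero W stars inv =
    inj₁ (stars , sym (+-identityʳ _) , vertices-unique , hyperedges-unique , λ m → W-notBig _ (vertices⊆W m))
    where open Invariant inv
  collectCherries (suc fuel) W stars inv with cherry? W
  ... | yes c = subst (λ g → ManyStars g ⊎ NoCherry g) (sym (+-suc (length stars) fuel))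
                  (collectCherries fuel _ _ (proj₂ (step inv c)))
  ... | no ¬c = inj₂ (W , W-notBig , ≤-trans card-W (*-monoˡ-≤ R (m≤m+n (length stars) (suc fuel))) , ¬c)
    where open Invariant inv

  length-verticesS2 : ∀ (stars : List BergeS2) → length (concatMap verticesS2 stars) ≡ 3 * length stars
  length-verticesS2 []           = refl
  length-verticesS2 (_ ∷ stars) = trans (cong (3 +_) (length-verticesS2 stars)) (sym (*-suc 3 (length stars)))

  length-hyperedgesS2 : ∀ (stars : List BergeS2) → length (concatMap hyperedgesS2 stars) ≡ 2 * length stars
  length-hyperedgesS2 []           = refl
  length-hyperedgesS2 (_ ∷ stars) = trans (cong (2 +_) (length-hyperedgesS2 stars)) (sym (*-suc 2 (length stars)))

  -- The s huge vertices complete k - s cherries to k disjoint Berge-S2's.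
  ¬ManyStars : s ≤ k → ¬ ManyStars (k ∸ s)
  ¬ManyStars s≤k (stars , length-stars , uV , uΦ , stars-small) =
    free (containsBerge-M∪S2 [] (stars ++ bigStars) uV-all uΦ-all t (k ∸ t) z≤n t+[k∸t]≡all)
    where
    V = concatMap verticesS2 stars
    Φ = concatMap hyperedgesS2 stars
    uBig++V : Unique (Big ++ V)
    uBig++V = UniqueP.++⁺ Big-unique uV (λ (m₁ , m₂) → true≢false (Big⇒lookup m₁) (stars-small m₂))
    [k∸s]+s≡k : (k ∸ s) + s ≡ k
    [k∸s]+s≡k = m∸n+n≡m s≤k
    room : ∀ c (xs : List BergeS2) → length xs ≡ k ∸ s → c ≤ 3 → c * length xs + c * s ≤ K
    room c xs length-xs c≤3 = ≤-trans (≤-reflexive (trans (sym (*-distribˡ-+ c (length xs) s))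
                                                          (cong (c *_) (trans (cong (_+ s) length-xs) [k∸s]+s≡k))))
                                      (≤-trans (*-monoˡ-≤ k c≤3) 3k≤K)
    greedy = greedyStars K Big (All.tabulate Big-huge) V Φ uBig++V uΦ
               (subst (_≤ K) (cong (_+ 3 * s) (sym (length-verticesS2 stars))) (room 3 stars length-stars ≤-refl))
               (subst (_≤ K) (cong (_+ 2 * s) (sym (length-hyperedgesS2 stars))) (room 2 stars length-stars (s≤s (s≤s z≤n))))
    bigStars = proj₁ greedy
    uV-all : Unique (concatMap verticesS2 (stars ++ bigStars))
    uV-all = subst Unique (sym (concatMap-++ verticesS2 stars bigStars)) (proj₁ (proj₂ (proj₂ greedy)))
    uΦ-all : Unique (concatMap hyperedgesS2 (stars ++ bigStars))
    uΦ-all = subst Unique (sym (concatMap-++ hyperedgesS2 stars bigStars)) (proj₂ (proj₂ (proj₂ greedy)))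
    t+[k∸t]≡all : t + (k ∸ t) ≡ length (stars ++ bigStars)
    t+[k∸t]≡all = begin
      t + (k ∸ t)                       ≡⟨ m+[n∸m]≡n t≤k ⟩
      k                                 ≡⟨ [k∸s]+s≡k ⟨
      (k ∸ s) + s                       ≡⟨ cong₂ _+_ (sym length-stars) (sym (proj₁ (proj₂ greedy))) ⟩
      length stars + length bigStars    ≡⟨ length-++ stars ⟨
      length (stars ++ bigStars)        ∎
      where open ≡-Reasoning

  few? : Subset n → Bool
  few? S = outside BigSet S ≤ᵇ 1

  meetsCount : Subset n → Subset n → ℕ
  meetsCount W S = sumFin n (λ v → 𝟙 (lookup S v ∧ lookup W v))

  meets? : Subset n → Subset n → Bool
  meets? W S = 1 ≤ᵇ meetsCount W S

  loose? : Subset n → Subset n → Bool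
  loose? W S = not (few? S) ∧ not (meets? W S)

  Loose : Subset n → List (Subset n)
  Loose W = filterᵇ (loose? W) hs

  Loose⇒ : ∀ W {S} → S ∈ Loose W → S ∈ hs × ¬ (outside BigSet S ≤ 1) × Avoids W S
  Loose⇒ W {S} m = S∈hs , ¬few , avoids
    where
    S∈hs = proj₁ (∈-filterᵇ⁻ (loose? W) {hs} m)
    flags = proj₂ (∈-filterᵇ⁻ (loose? W) {hs} m)
    ¬few : ¬ (outside BigSet S ≤ 1)
    ¬few few = true≢false (T⇒≡true (≤⇒≤ᵇ few)) (not≡true (BoolP.∧-conicalˡ _ _ flags))
    avoids : Avoids W S
    avoids w Sw with lookup W w in Ww
    ... | false = refl
    ... | true  = ⊥-elim (true≢false (T⇒≡true (≤⇒≤ᵇ meets)) (not≡true (BoolP.∧-conicalʳ _ _ flags)))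
      where
      meets : 1 ≤ meetsCount W S
      meets = ≤-trans (≤-reflexive (cong 𝟙 (sym (trans (cong (lookup S w ∧_) Ww) (trans (cong (_∧ true) Sw) refl)))))
                      (term≤sumFin n (λ v → 𝟙 (lookup S v ∧ lookup W v)) w)

  Small : Fin n → Set
  Small v = lookup BigSet v ≡ false

  noCherry : ∀ W → ¬ Cherry W → ∀ {T₁ T₂} → T₁ ∈ Loose W → T₂ ∈ Loose W → T₁ ≢ T₂ → ∀ {v a c} →
    Small v → Small a → Small c → v ≢ a → v ≢ c → a ≢ c →
    lookup T₁ v ≡ true → lookup T₁ a ≡ true → lookup T₂ v ≡ true → lookup T₂ c ≡ true → ⊥
  noCherry W ¬c {T₁} {T₂} m₁ m₂ T₁≢T₂ {v} {a} {c} v-small a-small c-small v≢a v≢c a≢c T₁v T₁a T₂v T₂c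
    with Loose⇒ W m₁ | Loose⇒ W m₂
  ... | T₁∈hs , ¬few₁ , avoids₁ | T₂∈hs , ¬few₂ , avoids₂ =
    ¬c (index T₁∈hs , index T₂∈hs , i≢j , good T₁∈hs ¬few₁ avoids₁ , good T₂∈hs ¬few₂ avoids₂ ,
        v , a , c , (v-small , a-small , c-small) , (v≢a , v≢c , a≢c) ,
        (∈ₛ-index T₁∈hs T₁v , ∈ₛ-index T₁∈hs T₁a , ∈ₛ-index T₂∈hs T₂v , ∈ₛ-index T₂∈hs T₂c))
    where
    i≢j : index T₁∈hs ≢ index T₂∈hs
    i≢j i≡j = T₁≢T₂ (trans (lookup-index T₁∈hs) (trans (cong e i≡j) (sym (lookup-index T₂∈hs))))
    good : ∀ {T} (T∈hs : T ∈ hs) → ¬ (outside BigSet T ≤ 1) → Avoids W T → Good W (index T∈hs)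
    good T∈hs ¬few avoids = subst (λ U → 2 ≤ outside BigSet U × Avoids W U) (lookup-index T∈hs) (≰⇒> ¬few , avoids)

  smallOtherThan : ∀ (S : Subset n) v → ¬ (outside BigSet S ≤ 1) → Σ (Fin n) λ x → x ≢ v × lookup S x ≡ true × Small x
  smallOtherThan S v ¬few with twoOutside BigSet S ¬few
  ... | a , b , a≢b , (Sa , a-small) , (Sb , b-small) with a FinP.≟ v
  ...   | no  a≢v  = a , a≢v , Sa , a-small
  ...   | yes refl = b , (λ b≡a → a≢b (sym b≡a)) , Sb , b-small

  core : Subset n → Subset n
  core S = tabulate (λ w → lookup S w ∧ lookup BigSet w)

  card≡core+outside : ∀ S → card S ≡ card (core S) + outside BigSet S
  card≡core+outside S = trans (sumFin-cong n pointwise) (sumFin-+ n _ _)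
    where
    pointwise : ∀ w → 𝟙 (lookup S w) ≡ 𝟙 (lookup (core S) w) + 𝟙 (lookup S w ∧ not (lookup BigSet w))
    pointwise w rewrite VecP.lookup∘tabulate (λ w → lookup S w ∧ lookup BigSet w) w with lookup S w | lookup BigSet w
    ... | true  | true  = refl
    ... | true  | false = refl
    ... | false | _     = refl

  outside-core : ∀ S → outside BigSet (core S) ≡ 0
  outside-core S = sumFin-zero n pointwise
    where
    pointwise : ∀ w → 𝟙 (lookup (core S) w ∧ not (lookup BigSet w)) ≡ 0
    pointwise w rewrite VecP.lookup∘tabulate (λ w → lookup S w ∧ lookup BigSet w) w with lookup S w | lookup BigSet w
    ... | true  | true  = refl
    ... | true  | false = refl
    ... | false | _     = refl

  Cores : List (Subset n)
  Cores = filterᵇ (fewOutside BigSet (r₀ ∸ 1) 0) (allSubsets n)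

  length-Cores : length Cores ≡ choose s (r₀ ∸ 1)
  length-Cores = trans (length-filterᵇ _ (allSubsets n))
    (trans (count-fewOutside₀ BigSet (r₀ ∸ 1)) (cong (λ c → choose c (r₀ ∸ 1)) (card-fromList Big Big-unique)))

  -- Two distinct loose hyperedges through a small vertex v pin down a second small vertex x:
  -- every loose hyperedge through v has small part exactly {v, x}, so it is determined by its core.
  module ThroughSmall (W : Subset n) (¬c : ¬ Cherry W) (v : Fin n) (v-small : Small v)
                      (X : List (Subset n)) (X-loose : ∀ {S} → S ∈ X → S ∈ Loose W × lookup S v ≡ true)
                      {S₁ S₂ : Subset n} (S₁∈X : S₁ ∈ X) (S₂∈X : S₂ ∈ X) (S₁≢S₂ : S₁ ≢ S₂)
                      {x y : Fin n} (x≢v : x ≢ v) (S₁x : lookup S₁ x ≡ true) (x-small : Small x)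
                      (y≢v : y ≢ v) (S₂y : lookup S₂ y ≡ true) (y-small : Small y) where

    private
      ¬few : ∀ {S} → S ∈ X → ¬ (outside BigSet S ≤ 1)
      ¬few S∈X = proj₁ (proj₂ (Loose⇒ W (proj₁ (X-loose S∈X))))
      loose : ∀ {S} → S ∈ X → S ∈ Loose W
      loose = proj₁ ∘ X-loose
      through-v : ∀ {S} → S ∈ X → lookup S v ≡ true
      through-v = proj₂ ∘ X-loose

    smallPart : ∀ {S} → S ∈ X → ∀ w → lookup S w ≡ true → Small w → w ≡ v ⊎ w ≡ x
    smallPart {S} S∈X w Sw w-small with w FinP.≟ v | w FinP.≟ x
    ... | yes w≡v | _       = inj₁ w≡v
    ... | no  _   | yes w≡x = inj₂ w≡x
    ... | no  w≢v | no  w≢x with S ≟ₛ S₁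
    ...   | no S≢S₁ = ⊥-elim (noCherry W ¬c (loose S₁∈X) (loose S∈X) (≢-sym S≢S₁) v-small x-small w-small
                        (≢-sym x≢v) (≢-sym w≢v) (≢-sym w≢x) (through-v S₁∈X) S₁x (through-v S∈X) Sw)
    ...   | yes refl with x FinP.≟ y
    ...     | no  x≢y = ⊥-elim (noCherry W ¬c (loose S₁∈X) (loose S₂∈X) S₁≢S₂ v-small x-small y-small
                          (≢-sym x≢v) (≢-sym y≢v) x≢y (through-v S₁∈X) S₁x (through-v S₂∈X) S₂y)
    ...     | yes refl = ⊥-elim (noCherry W ¬c (loose S₂∈X) (loose S₁∈X) (≢-sym S₁≢S₂) v-small y-small w-small
                          (≢-sym y≢v) (≢-sym w≢v) (≢-sym w≢x) (through-v S₂∈X) S₂y (through-v S₁∈X) Sw)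

    through-x : ∀ {S} → S ∈ X → lookup S x ≡ true
    through-x {S} S∈X with twoOutside BigSet S (¬few S∈X)
    ... | a , b , a≢b , (Sa , a-small) , (Sb , b-small) with smallPart S∈X a Sa a-small | smallPart S∈X b Sb b-small
    ...   | inj₂ refl | _         = Sa
    ...   | inj₁ _    | inj₂ refl = Sb
    ...   | inj₁ refl | inj₁ refl = ⊥-elim (a≢b refl)

    outside≡2 : ∀ {S} → S ∈ X → outside BigSet S ≡ 2
    outside≡2 {S} S∈X = sumFin-pair n v x (≢-sym x≢v) at-v at-x elsewhere
      where
      at-v : 𝟙 (lookup S v ∧ not (lookup BigSet v)) ≡ 1
      at-v rewrite through-v S∈X | v-small = refl
      at-x : 𝟙 (lookup S x ∧ not (lookup BigSet x)) ≡ 1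
      at-x rewrite through-x S∈X | x-small = refl
      elsewhere : ∀ w → w ≢ v → w ≢ x → 𝟙 (lookup S w ∧ not (lookup BigSet w)) ≡ 0
      elsewhere w w≢v w≢x with lookup S w in Sw | lookup BigSet w in Bw
      ... | false | _     = refl
      ... | true  | true  = refl
      ... | true  | false with smallPart S∈X w Sw Bw
      ...   | inj₁ w≡v = ⊥-elim (w≢v w≡v)
      ...   | inj₂ w≡x = ⊥-elim (w≢x w≡x)

    core∈Cores : ∀ {S} → S ∈ X → core S ∈ Cores
    core∈Cores {S} S∈X = ∈-filterᵇ⁺ _ (∈-allSubsets (core S))
      (fewOutside-complete BigSet (r₀ ∸ 1) 0 (core S) card-core (≤-reflexive (outside-core S)))
      where
      card-S : card S ≡ suc r₀
      card-S = All.lookup uniform′ (proj₁ (Loose⇒ W (loose S∈X)))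
      card-core : card (core S) ≡ r₀ ∸ 1
      card-core = trans (sym (m+n∸n≡m (card (core S)) 2)) (cong (_∸ 2) (begin
        card (core S) + 2                   ≡⟨ cong (card (core S) +_) (outside≡2 S∈X) ⟨
        card (core S) + outside BigSet S    ≡⟨ card≡core+outside S ⟨
        card S                              ≡⟨ card-S ⟩
        suc r₀                              ∎))
        where open ≡-Reasoning

    core-injective : ∀ {S T} → S ∈ X → T ∈ X → core S ≡ core T → S ≡ T
    core-injective {S} {T} S∈X T∈X eq = subset-ext S T agree
      where
      agree : ∀ w → lookup S w ≡ lookup T w
      agree w with lookup BigSet w in Bw
      ... | true = begin
        lookup S w                      ≡⟨ BoolP.∧-identityʳ _ ⟨
        lookup S w ∧ true               ≡⟨ cong (lookup S w ∧_) Bw ⟨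
        lookup S w ∧ lookup BigSet w    ≡⟨ VecP.lookup∘tabulate (λ w → lookup S w ∧ lookup BigSet w) w ⟨
        lookup (core S) w               ≡⟨ cong (λ U → lookup U w) eq ⟩
        lookup (core T) w               ≡⟨ VecP.lookup∘tabulate (λ w → lookup T w ∧ lookup BigSet w) w ⟩
        lookup T w ∧ lookup BigSet w    ≡⟨ cong (lookup T w ∧_) Bw ⟩
        lookup T w ∧ true               ≡⟨ BoolP.∧-identityʳ _ ⟩
        lookup T w                      ∎
        where open ≡-Reasoning
      ... | false with w FinP.≟ v | w FinP.≟ x
      ...   | yes refl | _        = trans (through-v S∈X) (sym (through-v T∈X))
      ...   | no _     | yes refl = trans (through-x S∈X) (sym (through-x T∈X))
      ...   | no w≢v   | no w≢x with lookup S w in Sw | lookup T w in Tw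
      ...     | false | false = refl
      ...     | true  | _     = ⊥-elim ([ w≢v , w≢x ]′ (smallPart S∈X w Sw Bw))
      ...     | false | true  = ⊥-elim ([ w≢v , w≢x ]′ (smallPart T∈X w Tw Bw))

    length≤choose : Unique X → length X ≤ choose s (r₀ ∸ 1)
    length≤choose uX = subst (length X ≤_) length-Cores (length≤-injectiveOn _≟ₛ_ core uX core-injective core∈Cores)

  perSmall : ℕ
  perSmall = choose s (r₀ ∸ 1) ⊔ 1

  looseThrough≤ : ∀ W → ¬ Cherry W → ∀ v → Small v → (X : List (Subset n)) → Unique X →
    (∀ {S} → S ∈ X → S ∈ Loose W × lookup S v ≡ true) → length X ≤ perSmall
  looseThrough≤ W ¬c v v-small []          uX X-loose = z≤n
  looseThrough≤ W ¬c v v-small (S₁ ∷ [])   uX X-loose = m≤n⊔m _ 1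
  looseThrough≤ W ¬c v v-small X@(S₁ ∷ S₂ ∷ _) uX@((S₁≢S₂ ∷ _) ∷ _) X-loose
    with smallOtherThan S₁ v (¬few (here refl)) | smallOtherThan S₂ v (¬few (there (here refl)))
    where
    ¬few : ∀ {S} → S ∈ X → ¬ (outside BigSet S ≤ 1)
    ¬few S∈X = proj₁ (proj₂ (Loose⇒ W (proj₁ (X-loose S∈X))))
  ... | x , x≢v , S₁x , x-small | y , y≢v , S₂y , y-small =
    ≤-trans (ThroughSmall.length≤choose W ¬c v v-small X X-loose (here refl) (there (here refl)) S₁≢S₂
               x≢v S₁x x-small y≢v S₂y y-small uX)
            (m≤m⊔n _ 1)

  count-few : countᵇ few? hs ≤ choose s (suc r₀) + (n ∸ s) * choose s r₀
  count-few = subst₂ _≤_ (length-filterᵇ few? hs)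
    (trans (count-fewOutside₁ BigSet r₀) (cong (λ c → choose c (suc r₀) + (n ∸ c) * choose c r₀) (card-fromList Big Big-unique)))
    (length≤countᵇ _≟ₛ_ (fewOutside BigSet (suc r₀) 1) (filterᵇ few? hs) (allSubsets n) (filterᵇ-unique few? (distinct H))
      (All.tabulate (λ {S} m → fewOutside-complete BigSet (suc r₀) 1 S
        (All.lookup uniform′ (proj₁ (∈-filterᵇ⁻ few? {hs} m))) (≤ᵇ⇒≤ _ _ (≡true⇒T (proj₂ (∈-filterᵇ⁻ few? {hs} m))))))
      (λ {S} _ → ∈-allSubsets S))

  count-¬few : ∀ W → countᵇ (not ∘ few?) hs ≤ countᵇ (meets? W) hs + countᵇ (loose? W) hs
  count-¬few W = countᵇ-≤-∨ _ (meets? W) (loose? W) hs meetsOrLoose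
    where
    meetsOrLoose : ∀ S → S ∈ hs → not (few? S) ≡ true → meets? W S ≡ true ⊎ loose? W S ≡ true
    meetsOrLoose S _ ¬few with meets? W S
    ... | true  = inj₁ refl
    ... | false = inj₂ (trans (BoolP.∧-identityʳ _) ¬few)

  -- Each vertex of W is small, so lies in fewer than D hyperedges.
  count-meets : ∀ W → NotBig W → countᵇ (meets? W) hs ≤ card W * D
  count-meets W W-notBig = begin
    countᵇ (meets? W) hs
      ≤⟨ countᵇ≤sum (meets? W) (meetsCount W) hs (λ S _ → 𝟙-1≤ᵇ (meetsCount W S)) ⟩
    sum (map (meetsCount W) hs)
      ≡⟨ sum-sumFin-swap n (λ S v → lookup S v ∧ lookup W v) hs ⟩
    sumFin n (λ v → countᵇ (λ S → lookup S v ∧ lookup W v) hs)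
      ≤⟨ sumFin-mono n pointwise ⟩
    sumFin n (λ v → 𝟙 (lookup W v) * D)
      ≡⟨ sumFin-*ʳ n (λ v → 𝟙 (lookup W v)) D ⟩
    card W * D ∎
    where
    open ≤-Reasoning
    𝟙-1≤ᵇ : ∀ m → 𝟙 (1 ≤ᵇ m) ≤ m
    𝟙-1≤ᵇ zero    = z≤n
    𝟙-1≤ᵇ (suc m) = s≤s z≤n
    pointwise : ∀ v → countᵇ (λ S → lookup S v ∧ lookup W v) hs ≤ 𝟙 (lookup W v) * D
    pointwise v with lookup W v in Wv
    ... | false = ≤-reflexive (countᵇ-none hs (λ S → BoolP.∧-zeroʳ _))
    ... | true  = ≤-trans (≤-reflexive (countᵇ-cong hs (λ S → BoolP.∧-identityʳ _)))
                          (≤-trans (<⇒≤ (notBig⇒deg<D v (W-notBig v Wv))) (≤-reflexive (sym (+-identityʳ D))))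

  -- Double counting pairs (small vertex, loose hyperedge through it).
  count-loose : ∀ W → ¬ Cherry W → 2 * countᵇ (loose? W) hs ≤ (n ∸ s) * perSmall
  count-loose W ¬c = begin
    2 * countᵇ (loose? W) hs ≡⟨ cong (2 *_) (length-filterᵇ (loose? W) hs) ⟨
    2 * length (Loose W)
      ≤⟨ *-length≤sum 2 (outside BigSet) (Loose W) (λ S m → ≰⇒> (proj₁ (proj₂ (Loose⇒ W m)))) ⟩
    sum (map (outside BigSet) (Loose W))
      ≡⟨ sum-sumFin-swap n (λ S v → lookup S v ∧ not (lookup BigSet v)) (Loose W) ⟩
    sumFin n (λ v → countᵇ (λ S → lookup S v ∧ not (lookup BigSet v)) (Loose W))
      ≤⟨ sumFin-mono n pointwise ⟩
    sumFin n (λ v → 𝟙 (not (lookup BigSet v)) * perSmall)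
      ≡⟨ sumFin-*ʳ n (λ v → 𝟙 (not (lookup BigSet v))) perSmall ⟩
    sumFin n (λ v → 𝟙 (not (lookup BigSet v))) * perSmall
      ≡⟨ cong (_* perSmall) small-count ⟩
    (n ∸ s) * perSmall ∎
    where
    open ≤-Reasoning
    small-count : sumFin n (λ v → 𝟙 (not (lookup BigSet v))) ≡ n ∸ s
    small-count = trans (sym (m+n∸n≡m _ (card BigSet)))
                        (trans (cong (_∸ card BigSet) (outside+card BigSet)) (cong (n ∸_) (card-fromList Big Big-unique)))
    pointwise : ∀ v → countᵇ (λ S → lookup S v ∧ not (lookup BigSet v)) (Loose W) ≤ 𝟙 (not (lookup BigSet v)) * perSmall
    pointwise v with lookup BigSet v in Bv
    ... | true  = ≤-reflexive (countᵇ-none (Loose W) (λ S → BoolP.∧-zeroʳ _))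
    ... | false = begin
      countᵇ (λ S → lookup S v ∧ true) (Loose W)        ≡⟨ countᵇ-cong (Loose W) (λ S → BoolP.∧-identityʳ _) ⟩
      countᵇ (λ S → lookup S v) (Loose W)               ≡⟨ length-filterᵇ _ (Loose W) ⟨
      length (filterᵇ (λ S → lookup S v) (Loose W))
        ≤⟨ looseThrough≤ W ¬c v Bv _ (filterᵇ-unique _ (filterᵇ-unique (loose? W) (distinct H))) (∈-filterᵇ⁻ _ {Loose W}) ⟩
      perSmall                                          ≡⟨ +-identityʳ perSmall ⟨
      1 * perSmall                                      ∎

  noCherry⇒bound : ∀ W → NotBig W → ¬ Cherry W →
    2 * length hs ≤ 2 * (choose s (suc r₀) + (n ∸ s) * choose s r₀) + 2 * (card W * D) + (n ∸ s) * perSmall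
  noCherry⇒bound W W-notBig ¬c = begin
    2 * length hs                                              ≡⟨ cong (2 *_) (countᵇ+countᵇ-not few? hs) ⟨
    2 * (countᵇ few? hs + countᵇ (not ∘ few?) hs)              ≤⟨ *-monoʳ-≤ 2 (+-monoʳ-≤ (countᵇ few? hs) (count-¬few W)) ⟩
    2 * (countᵇ few? hs + (countᵇ (meets? W) hs + countᵇ (loose? W) hs))
      ≡⟨ distribute (countᵇ few? hs) (countᵇ (meets? W) hs) (countᵇ (loose? W) hs) ⟩
    2 * countᵇ few? hs + 2 * countᵇ (meets? W) hs + 2 * countᵇ (loose? W) hs
      ≤⟨ +-mono-≤ (+-mono-≤ (*-monoʳ-≤ 2 count-few) (*-monoʳ-≤ 2 (count-meets W W-notBig))) (count-loose W ¬c) ⟩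
    2 * (choose s (suc r₀) + (n ∸ s) * choose s r₀) + 2 * (card W * D) + (n ∸ s) * perSmall ∎
    where
    open ≤-Reasoning
    distribute : ∀ a b c → 2 * (a + (b + c)) ≡ 2 * a + 2 * b + 2 * c
    distribute = solve-∀

  lowerOrder-bound : ∀ {w δ} → s ≤ k → w ≤ (k ∸ s) * R → δ ≤ k →
    2 * choose s (suc r₀) + 2 * δ * choose s r₀ + 2 * (w * D) + δ * perSmall ≤ lowerOrder k r₀
  lowerOrder-bound s≤k w≤ δ≤k =
    +-mono-≤ (+-mono-≤ (+-mono-≤ (*-monoʳ-≤ 2 (≤2^k (choose≤2^ s (suc r₀))))
                                 (*-mono-≤ (*-monoʳ-≤ 2 δ≤k) (≤2^k (choose≤2^ s r₀))))
                       (*-monoʳ-≤ 2 (*-monoˡ-≤ D (≤-trans w≤ (*-monoˡ-≤ R (m∸n≤m k s))))))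
             (*-mono-≤ δ≤k (⊔-lub (≤2^k (choose≤2^ s (r₀ ∸ 1))) (m^n>0 2 k)))
    where
    ≤2^k : ∀ {m} → m ≤ 2 ^ s → m ≤ 2 ^ k
    ≤2^k m≤ = ≤-trans m≤ (^-monoʳ-≤ 2 s≤k)

  fewBig⇒bound : 2 ≤ k → 1 ≤ r₀ → suc r₀ ≤ k → threshold k r₀ ≤ n → suc s ≤ k ∸ 1 →
    length hs ≤ choose (k ∸ 1) (suc r₀) + (n ∸ (k ∸ 1)) * choose (k ∸ 1) r₀
  fewBig⇒bound 2≤k 1≤r₀ r≤k N≤n s<k-1 with collectCherries (k ∸ s) (replicate n false) [] invariant-[]
  ... | inj₁ many = ⊥-elim (¬ManyStars (≤-trans (n≤1+n s) (≤-trans s<k-1 (m∸n≤m k 1))) many)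
  ... | inj₂ (W , W-notBig , card-W , ¬c) =
    absorb-lower-order (length hs) (choose s (suc r₀)) (choose s r₀) (choose (k ∸ 1) (suc r₀)) (choose (k ∸ 1) r₀)
      perSmall (card W * D) (n ∸ (k ∸ 1)) δ
      (subst (λ z → 2 * length hs ≤ 2 * (choose s (suc r₀) + z * choose s r₀) + 2 * (card W * D) + z * perSmall)
             n∸s≡ (noCherry⇒bound W W-notBig ¬c))
      pascal (m≤n⊔m _ 1) lower-order
    where
    δ = (k ∸ 1) ∸ s
    s≤k-1 = ≤-trans (n≤1+n s) s<k-1
    k-1≤n : k ∸ 1 ≤ n
    k-1≤n = ≤-trans (m∸n≤m k 1) (≤-trans (m≤n+m k _) N≤n)
    n∸s≡ : n ∸ s ≡ (n ∸ (k ∸ 1)) + δ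
    n∸s≡ = +-cancelʳ-≡ s _ _ (begin
      n ∸ s + s                       ≡⟨ m∸n+n≡m (≤-trans s≤k-1 k-1≤n) ⟩
      n                               ≡⟨ m∸n+n≡m k-1≤n ⟨
      (n ∸ (k ∸ 1)) + (k ∸ 1)         ≡⟨ cong ((n ∸ (k ∸ 1)) +_) (m∸n+n≡m s≤k-1) ⟨
      (n ∸ (k ∸ 1)) + (δ + s)         ≡⟨ +-assoc (n ∸ (k ∸ 1)) δ s ⟨
      (n ∸ (k ∸ 1)) + δ + s           ∎)
      where open ≡-Reasoning
    pascal : choose s r₀ + perSmall ≤ choose (k ∸ 1) r₀
    pascal = subst₂ (λ a b → choose s a + perSmall ≤ choose b a) (m+[n∸m]≡n 1≤r₀) (m+[n∸m]≡n (∸-monoˡ-≤ 1 2≤k))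
      (choose-pascal-bound (r₀ ∸ 1) (∸-monoˡ-≤ 1 s<k-1) (∸-monoˡ-≤ 1 (∸-monoˡ-≤ 1 r≤k)))
    lower-order : 2 * choose s (suc r₀) + 2 * δ * choose s r₀ + 2 * (card W * D) + δ * perSmall ≤ n ∸ (k ∸ 1)
    lower-order = begin
      2 * choose s (suc r₀) + 2 * δ * choose s r₀ + 2 * (card W * D) + δ * perSmall
        ≤⟨ lowerOrder-bound (≤-trans s≤k-1 (m∸n≤m k 1)) card-W (≤-trans (m∸n≤m (k ∸ 1) s) (m∸n≤m k 1)) ⟩
      lowerOrder k r₀             ≡⟨ m+n∸n≡m (lowerOrder k r₀) k ⟨
      threshold k r₀ ∸ k          ≤⟨ ∸-monoˡ-≤ k N≤n ⟩
      n ∸ k                       ≤⟨ ∸-monoʳ-≤ n (m∸n≤m k 1) ⟩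
      n ∸ (k ∸ 1)                 ∎
      where open ≤-Reasoning

  upperBound : 2 ≤ k → 1 ≤ r₀ → suc r₀ ≤ k → threshold k r₀ ≤ n →
    length hs ≤ choose (k ∸ 1) (suc r₀) + (n ∸ (k ∸ 1)) * choose (k ∸ 1) r₀
  upperBound 2≤k 1≤r₀ r≤k N≤n with (k ∸ 1) ≤? s
  ... | yes k-1≤s = manyBig⇒bound k-1≤s
  ... | no  k-1≰s = fewBig⇒bound 2≤k 1≤r₀ r≤k N≤n (≰⇒> k-1≰s)

choose-form : ∀ a r m → choose a (suc r) + m * choose a r ≡ (a C r) * m + a C (suc r)
choose-form a r m = trans (+-comm (choose a (suc r)) _)
  (cong₂ _+_ (trans (*-comm m _) (cong (_* m) (choose≡C a r))) (choose≡C a (suc r)))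

n∸[k∸1]≡n∸k+1 : ∀ {n k} → 1 ≤ k → k ≤ n → n ∸ (k ∸ 1) ≡ n ∸ k + 1
n∸[k∸1]≡n∸k+1 {suc n} {suc k} _ (s≤s k≤n) = trans (+-∸-assoc 1 k≤n) (+-comm 1 (n ∸ k))

corollary2p2 : (k r t : ℕ) → 2 ≤ k → 2 ≤ r → r ≤ k → 1 ≤ t → t ≤ k →
    Σ ℕ λ N → (n : ℕ) → N ≤ n →
      IsExBerge r n (M t ∪G copies (k ∸ t) S2)
        (((k ∸ 1) C (r ∸ 1)) * (n ∸ k + 1) + ((k ∸ 1) C r))
corollary2p2 k (suc r₀) t 2≤k (s≤s 1≤r₀) r≤k 1≤t t≤k = threshold k r₀ , λ n N≤n →
  let k≤n = ≤-trans (m≤n+m k (lowerOrder k r₀)) N≤n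
      extremal≡ = trans (cong (λ m → choose (k ∸ 1) (suc r₀) + m * choose (k ∸ 1) r₀) (n∸[k∸1]≡n∸k+1 1≤k k≤n))
                        (choose-form (k ∸ 1) r₀ (n ∸ k + 1))
  in (nearInitial n (k ∸ 1) (suc r₀)
     , nearInitial-free n (k ∸ 1) (suc r₀) t (k ∸ t) k-1<t+[k∸t]
     , trans (length-nearInitial n (k ∸ 1) r₀ (≤-trans (m∸n≤m k 1) k≤n)) extremal≡)
   , λ H free → subst (length (hedges H) ≤_) extremal≡ (UpperBound.upperBound H k t 1≤t t≤k free 2≤k 1≤r₀ r≤k N≤n)
  where
  1≤k = ≤-trans 1≤t t≤k
  k-1<t+[k∸t] : k ∸ 1 < t + (k ∸ t)
  k-1<t+[k∸t] = subst (k ∸ 1 <_) (sym (m+[n∸m]≡n t≤k)) (∸-monoʳ-< (s≤s z≤n) 1≤k)
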